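{- Let an \emph{$\mathrm{SL}_2$-tiling over $\mathbb{Z}$} be a bi-infinite array $M=(m_{i,j})_{i,j\in\mathbb{Z}}$ of integers such that $m_{i,j}m_{i+1,j+1}-m_{i,j+1}m_{i+1,j}=1$ for all $i,j\in\mathbb{Z}$. Call an entry $m_{i,j}$ \emph{wild} if \[ \det\begin{pmatrix} m_{i-1,j-1} & m_{i-1,j} & m_{i-1,j+1}\\ m_{i,j-1} & m_{i,j} & m_{i,j+1}\\ m_{i+1,j-1} & m_{i+1,j} & m_{i+1,j+1} \end{pmatrix}\neq 0, \] and define the \emph{wild density} of $M$ as \[ \limsup_{r\to\infty}\frac{\#\{(i,j)\in\mathbb{Z}^2:\ i^2+j^2\le r^2,\ m_{i,j}\text{ is wild}\}}{\#\{(i,j)\in\mathbb{Z}^2:\ i^2+j^2\le r^2\}}. \] Then every $\mathrm{SL}_2$-tiling over $\mathbb{Z}$ has wild density at most $\tfrac25$, and this value is attained. Specifically, let $L=\{(i,j)\in\mathbb{Z}^2: j+3i\equiv 0 \pmod{10}\}$, choose arbitrary nonzero integers $a_{i,j}$ for $(i,j)\in L$, and set $m_{i,j}=a_{i,j}$ for $(i,j)\in L$ and $m_{i,j}=\sin\!\big(\pi(i-j)/2\big)\in\{0,1,-1\}$ for $(i,j)\notin L$. Then $M=(m_{i,j})$ is an $\mathrm{SL}_2$-tiling over $\mathbb{Z}$ with wild density exactly $\tfrac25$ (every zero entry of $M$ being wild).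
   Context: A tiling is called tame if no entry is wild, and wild otherwise. The maximum in the theorem is over all $\mathrm{SL}_2$-tilings with integer entries. -}

module Defs where

open import Data.Nat as ℕ using (ℕ; zero; suc)
open import Data.Integer as ℤ using (ℤ; +_; -[1+_]; _+_; _-_; _*_; -_)
open import Data.Integer.DivMod using (_%ℕ_)
open import Data.Rational as ℚ using (ℚ; Positive)
open import Data.List using (List; []; _∷_; map; concatMap; length; filter; applyUpTo)
open import Data.Product using (_×_; _,_; ∃-syntax)
open import Relation.Nullary using (¬_; Dec; yes; no)
open import Relation.Nullary.Decidable using (¬?; _×-dec_)
open import Relation.Binary.PropositionalEquality using (_≡_)

Array : Set
Array = ℤ → ℤ → ℤ

IsSL2Tiling : Array → Set
IsSL2Tiling M = ∀ i j →
  M i j * M (i + + 1) (j + + 1) - M i (j + + 1) * M (i + + 1) j ≡ + 1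

det3 : ℤ → ℤ → ℤ → ℤ → ℤ → ℤ → ℤ → ℤ → ℤ → ℤ
det3 a b c d e f g h k =
  a * (e * k - f * h) - b * (d * k - f * g) + c * (d * h - e * g)

centredDet : Array → ℤ → ℤ → ℤ
centredDet M i j =
  det3 (M (i - + 1) (j - + 1)) (M (i - + 1) j) (M (i - + 1) (j + + 1))
       (M i (j - + 1))         (M i j)         (M i (j + + 1))
       (M (i + + 1) (j - + 1)) (M (i + + 1) j) (M (i + + 1) (j + + 1))

Wild : Array → ℤ → ℤ → Set
Wild M i j = ¬ (centredDet M i j ≡ + 0)

wild? : (M : Array) → ∀ i j → Dec (Wild M i j)
wild? M i j = ¬? (centredDet M i j ℤ.≟ + 0)

range : ℕ → List ℤ
range n = applyUpTo (λ k → + k - + n) (suc (n ℕ.+ n))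

-- all (i,j) ∈ ℤ² with i² + j² ≤ R2  (all such points lie in [-R2,R2]²)
disc : ℕ → List (ℤ × ℤ)
disc R2 = filter (λ p → (Data.Product.proj₁ p * Data.Product.proj₁ p
                           + Data.Product.proj₂ p * Data.Product.proj₂ p) ℤ.≤? + R2)
                 (concatMap (λ i → map (λ j → (i , j)) (range R2)) (range R2))

discCount : ℕ → ℕ
discCount R2 = length (disc R2)

wildCount : Array → ℕ → ℕ
wildCount M R2 = length (filter (λ p → wild? M (Data.Product.proj₁ p) (Data.Product.proj₂ p)) (disc R2))

-- ratio of wild points in the disc of squared radius R2; the denominator is
-- nonzero (the origin lies in every disc) but we avoid division by
-- comparing  wildCount ≤ q * discCount  instead.
-- The ratio as a function of real r depends only on ⌊r²⌋, so
-- limsup over real r → ∞ equals limsup over R2 = ⌊r²⌋ ∈ ℕ → ∞.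

WildDensity≤ : Array → ℚ → Set
WildDensity≤ M q = ∀ (ε : ℚ) → Positive ε → ∃[ N ] ∀ R2 → N ℕ.≤ R2 →
  (+ wildCount M R2 ℚ./ 1) ℚ.≤ (q ℚ.+ ε) ℚ.* (+ discCount R2 ℚ./ 1)

WildDensity≥ : Array → ℚ → Set
WildDensity≥ M q = ∀ (ε : ℚ) → Positive ε → ∀ N → ∃[ R2 ] (N ℕ.≤ R2 ×
  (q ℚ.- ε) ℚ.* (+ discCount R2 ℚ./ 1) ℚ.≤ (+ wildCount M R2 ℚ./ 1))

WildDensity≡ : Array → ℚ → Set
WildDensity≡ M q = WildDensity≤ M q × WildDensity≥ M q

InL : ℤ → ℤ → Set
InL i j = ((j + + 3 * i) %ℕ 10) ≡ 0

InL? : ∀ i j → Dec (InL i j)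
InL? i j = ((j + + 3 * i) %ℕ 10) ℕ.≟ 0

sinHalfPi : ℤ → ℤ
sinHalfPi k with k %ℕ 4
... | 0 = + 0
... | 1 = + 1
... | 2 = + 0
... | _ = -[1+ 0 ]

construction : Array → Array
construction a i j with InL? i j
... | yes _ = a i j
... | no  _ = sinHalfPi (i - j)

{-# OPTIONS --safe #-}
-- Dodgson condensation gives centredDet · m = 1·1 − 1·1 = 0 at every entry m of an SL₂-tiling,
-- so wild entries are zeros.  Hence no two wild entries are orthogonally adjacent, and no wild
-- entry has four wild diagonal neighbours (with a zero centre the determinant is the sum of the
-- four corners).  Counting the W wild entries of the disc over 2×2 blocks gives 4W ≤ D + P, where
-- D is the number of lattice points and P the number of wild diagonal pairs, and counting pairs
-- through each wild entry gives 2P ≤ 3W.  Both hold up to translation errors of the order of the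
-- number of rows, which is negligible against D, so 5W ≤ 2D asymptotically.
-- In the construction every entry depends only on j + 3i modulo 20.  A zero is wild because
-- exactly one of its four diagonal neighbours lies on L, and every ten consecutive entries of a
-- row contain four zeros, so W ≥ 2D/5 up to boundary terms.
module Submission where

open import Defs
open import Data.Nat as ℕ using (ℕ; zero; suc; _+_; _*_; _∸_; _≤_; _<_; _≤?_; _%_; z≤n; s≤s; NonZero; ⌊_/2⌋; ⌈_/2⌉)
open import Data.Nat.Properties
open import Data.Nat.DivMod using (m%n<n; m<n⇒m%n≡m)
open import Data.Nat.Coprimality as Coprime using ()
open import Data.Nat.Tactic.RingSolver using (solve-∀)
open import Data.Integer as ℤ using (ℤ; +_; -[1+_]; ∣_∣; _%ℕ_; _/ℕ_)
import Data.Integer.Properties as ℤP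
open import Data.Integer.DivMod using (n%ℕd<d; a≡a%ℕn+[a/ℕn]*n)
import Data.Integer.Tactic.RingSolver as ℤSolver
open import Data.Rational as ℚ using (mkℚ; _/_; Positive; toℚᵘ; ↧ₙ_)
import Data.Rational.Properties as ℚP
import Data.Rational.Unnormalised as ℚᵘ
import Data.Rational.Unnormalised.Properties as ℚᵘP
open import Data.Empty using (⊥)
open import Data.List using (List; []; _∷_; _++_; map; concatMap; filter; length; applyUpTo; upTo)
open import Data.List.Relation.Unary.All as All using (All; all?)
open import Data.List.Membership.Propositional.Properties using (∈-upTo⁺)
open import Data.Product using (_×_; _,_; proj₁; proj₂; ∃-syntax)
open import Data.Sum using (_⊎_; inj₁; inj₂; [_,_])
open import Function using (_∘_; id; flip; _⇔_; mk⇔; Equivalence)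
open import Function.Properties.Equivalence using () renaming (trans to ⇔-trans)
open import Relation.Nullary using (Dec; yes; no; ¬_; contradiction)
open import Relation.Nullary.Decidable using (_×-dec_; from-yes)
open import Relation.Binary.PropositionalEquality hiding ([_])

χ : ∀ {p} {P : Set p} → Dec P → ℕ
χ (yes _) = 1
χ (no _)  = 0

χ≤1 : ∀ {p} {P : Set p} (P? : Dec P) → χ P? ≤ 1
χ≤1 (yes _) = s≤s z≤n
χ≤1 (no _)  = z≤n

χ-cong : ∀ {p q} {P : Set p} {Q : Set q} (P? : Dec P) (Q? : Dec Q) →
         (P → Q) → (Q → P) → χ P? ≡ χ Q?
χ-cong (yes _) (yes _) _   _   = refl
χ-cong (yes p) (no ¬q) p⇒q _   = contradiction (p⇒q p) ¬q
χ-cong (no ¬p) (yes q) _   q⇒p = contradiction (q⇒p q) ¬p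
χ-cong (no _)  (no _)  _   _   = refl

χ-yes : ∀ {p} {P : Set p} (P? : Dec P) → P → χ P? ≡ 1
χ-yes (yes _) _ = refl
χ-yes (no ¬p) p = contradiction p ¬p

χ-no : ∀ {p} {P : Set p} (P? : Dec P) → ¬ P → χ P? ≡ 0
χ-no (yes p) ¬p = contradiction p ¬p
χ-no (no _)  _  = refl

χ-×-dec : ∀ {p q} {P : Set p} {Q : Set q} (P? : Dec P) (Q? : Dec Q) →
          χ (P? ×-dec Q?) ≡ χ P? * χ Q?
χ-×-dec (yes _) (yes _) = refl
χ-×-dec (yes _) (no _)  = refl
χ-×-dec (no _)  _       = refl

Σ< : ℕ → (ℕ → ℕ) → ℕ
Σ< zero    f = 0
Σ< (suc n) f = Σ< n f + f n

Σ<-suc : ∀ n f → Σ< (suc n) f ≡ f 0 + Σ< n (f ∘ suc)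
Σ<-suc zero    f = +-comm 0 (f 0)
Σ<-suc (suc n) f = trans (cong (_+ f (suc n)) (Σ<-suc n f)) (+-assoc (f 0) _ _)

Σ<-mono : ∀ n {f g} → (∀ k → k < n → f k ≤ g k) → Σ< n f ≤ Σ< n g
Σ<-mono zero    f≤g = z≤n
Σ<-mono (suc n) f≤g = +-mono-≤ (Σ<-mono n (λ k k<n → f≤g k (m<n⇒m<1+n k<n))) (f≤g n ≤-refl)

Σ<-cong : ∀ n {f g} → (∀ k → k < n → f k ≡ g k) → Σ< n f ≡ Σ< n g
Σ<-cong zero    f≡g = refl
Σ<-cong (suc n) f≡g = cong₂ _+_ (Σ<-cong n (λ k k<n → f≡g k (m<n⇒m<1+n k<n))) (f≡g n ≤-refl)

Σ<-const : ∀ n c → Σ< n (λ _ → c) ≡ n * c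
Σ<-const zero    c = refl
Σ<-const (suc n) c = trans (cong (_+ c) (Σ<-const n c)) (+-comm (n * c) c)

Σ± : ℕ → (ℤ → ℕ) → ℕ
Σ± zero    f = f (+ 0)
Σ± (suc N) f = f -[1+ N ] + Σ± N f + f (+ suc N)

Σ±-cong : ∀ N {f g} → (∀ k → ∣ k ∣ ≤ N → f k ≡ g k) → Σ± N f ≡ Σ± N g
Σ±-cong zero    f≡g = f≡g (+ 0) z≤n
Σ±-cong (suc N) f≡g = cong₂ _+_ (cong₂ _+_ (f≡g -[1+ N ] ≤-refl)
                                          (Σ±-cong N (λ k k≤N → f≡g k (m≤n⇒m≤1+n k≤N))))
                               (f≡g (+ suc N) ≤-refl)

Σ±-mono : ∀ N {f g} → (∀ k → ∣ k ∣ ≤ N → f k ≤ g k) → Σ± N f ≤ Σ± N g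
Σ±-mono zero    f≤g = f≤g (+ 0) z≤n
Σ±-mono (suc N) f≤g = +-mono-≤ (+-mono-≤ (f≤g -[1+ N ] ≤-refl)
                                         (Σ±-mono N (λ k k≤N → f≤g k (m≤n⇒m≤1+n k≤N))))
                               (f≤g (+ suc N) ≤-refl)

Σ±-+ : ∀ N f g → Σ± N (λ k → f k + g k) ≡ Σ± N f + Σ± N g
Σ±-+ zero    f g = refl
Σ±-+ (suc N) f g rewrite Σ±-+ N f g = interchange (f -[1+ N ]) (g -[1+ N ]) (Σ± N f) (Σ± N g) (f (+ suc N)) (g (+ suc N))
  where
  interchange : ∀ a b c d e f → a + b + (c + d) + (e + f) ≡ a + c + e + (b + d + f)
  interchange = solve-∀

Σ±-* : ∀ N c f → Σ± N (λ k → c * f k) ≡ c * Σ± N f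
Σ±-* zero    c f = refl
Σ±-* (suc N) c f rewrite Σ±-* N c f = sym (distrib c (f -[1+ N ]) (Σ± N f) (f (+ suc N)))
  where
  distrib : ∀ c a b d → c * (a + b + d) ≡ c * a + c * b + c * d
  distrib = solve-∀

Σ±-const : ∀ N c → Σ± N (λ _ → c) ≡ suc (N + N) * c
Σ±-const zero    c = sym (+-identityʳ c)
Σ±-const (suc N) c rewrite Σ±-const N c = count N c
  where
  count : ∀ N c → c + suc (N + N) * c + c ≡ suc (suc N + suc N) * c
  count = solve-∀

Σ±-swap : ∀ M N (f : ℤ → ℤ → ℕ) →
          Σ± M (λ i → Σ± N (λ j → f i j)) ≡ Σ± N (λ j → Σ± M (λ i → f i j))
Σ±-swap zero    N f = refl
Σ±-swap (suc M) N f = begin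
  Σ± N (f -[1+ M ]) + Σ± M (λ i → Σ± N (f i)) + Σ± N (f (+ suc M))
    ≡⟨ cong (λ s → Σ± N (f -[1+ M ]) + s + Σ± N (f (+ suc M))) (Σ±-swap M N f) ⟩
  Σ± N (f -[1+ M ]) + Σ± N (λ j → Σ± M (λ i → f i j)) + Σ± N (f (+ suc M))
    ≡⟨ cong (_+ Σ± N (f (+ suc M))) (Σ±-+ N (f -[1+ M ]) _) ⟨
  Σ± N (λ j → f -[1+ M ] j + Σ± M (λ i → f i j)) + Σ± N (f (+ suc M))
    ≡⟨ Σ±-+ N _ (f (+ suc M)) ⟨
  Σ± N (λ j → Σ± (suc M) (λ i → f i j)) ∎
  where open ≡-Reasoning

Σ±-translate : ∀ N f → Σ± N (λ k → f (k ℤ.+ + 1)) + f (ℤ.- + N) ≡ Σ± N f + f (+ suc N)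
Σ±-translate zero    f = +-comm (f (+ 1)) (f (+ 0))
Σ±-translate (suc N) f = begin
  f (-[1+ N ] ℤ.+ + 1) + Σ± N g + f (+ suc N ℤ.+ + 1) + f -[1+ N ]
    ≡⟨ cong₂ (λ x y → f x + Σ± N g + f y + f -[1+ N ]) (-[1+n]+1≡-n (+ N)) (cong +_ (+-comm (suc N) 1)) ⟩
  f (ℤ.- + N) + Σ± N g + f (+ suc (suc N)) + f -[1+ N ]
    ≡⟨ rearrange (f (ℤ.- + N)) (Σ± N g) (f (+ suc (suc N))) (f -[1+ N ]) ⟩
  Σ± N g + f (ℤ.- + N) + f (+ suc (suc N)) + f -[1+ N ]
    ≡⟨ cong (λ s → s + f (+ suc (suc N)) + f -[1+ N ]) (Σ±-translate N f) ⟩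
  Σ± N f + f (+ suc N) + f (+ suc (suc N)) + f -[1+ N ]
    ≡⟨ rearrange′ (Σ± N f) (f (+ suc N)) (f (+ suc (suc N))) (f -[1+ N ]) ⟩
  f -[1+ N ] + Σ± N f + f (+ suc N) + f (+ suc (suc N)) ∎
  where
  open ≡-Reasoning
  g = λ k → f (k ℤ.+ + 1)
  -[1+n]+1≡-n : ∀ n → ℤ.- (+ 1 ℤ.+ n) ℤ.+ + 1 ≡ ℤ.- n
  -[1+n]+1≡-n = ℤSolver.solve-∀
  rearrange : ∀ a b c d → a + b + c + d ≡ b + a + c + d
  rearrange = solve-∀
  rearrange′ : ∀ a b c d → a + b + c + d ≡ d + a + b + c
  rearrange′ = solve-∀

Σ±-restrict : ∀ {s} N f → s ≤ N → Σ± N (λ k → χ (∣ k ∣ ≤? s) * f k) ≡ Σ± s f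
Σ±-restrict {s} N f s≤N with m≤n⇒m<n∨m≡n s≤N
... | inj₂ refl = Σ±-cong N (λ k k≤N → trans (cong (_* f k) (χ-yes (∣ k ∣ ≤? N) k≤N)) (+-identityʳ (f k)))
Σ±-restrict {s} (suc N) f _ | inj₁ (s≤s s≤N) = begin
  χ (suc N ≤? s) * f -[1+ N ] + Σ± N g + χ (suc N ≤? s) * f (+ suc N)
    ≡⟨ cong (λ c → c * f -[1+ N ] + Σ± N g + c * f (+ suc N)) outside ⟩
  Σ± N g + 0
    ≡⟨ +-identityʳ (Σ± N g) ⟩
  Σ± N g
    ≡⟨ Σ±-restrict N f s≤N ⟩
  Σ± s f ∎
  where
  open ≡-Reasoning
  g = λ k → χ (∣ k ∣ ≤? s) * f k
  outside : χ (suc N ≤? s) ≡ 0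
  outside = χ-no (suc N ≤? s) (<⇒≱ (s≤s s≤N))

Σ±-mono-radius : ∀ {s N} f → s ≤ N → Σ± s f ≤ Σ± N f
Σ±-mono-radius {s} {N} f s≤N = begin
  Σ± s f                                ≡⟨ Σ±-restrict N f s≤N ⟨
  Σ± N (λ k → χ (∣ k ∣ ≤? s) * f k)   ≤⟨ Σ±-mono N (λ k _ → χ*f≤f (∣ k ∣ ≤? s) (f k)) ⟩
  Σ± N f                                ∎
  where
  open ≤-Reasoning
  χ*f≤f : ∀ {p} {P : Set p} (P? : Dec P) x → χ P? * x ≤ x
  χ*f≤f (yes _) x = ≤-reflexive (+-identityʳ x)
  χ*f≤f (no _)  x = z≤n

ΣL : ∀ {a} {A : Set a} → List A → (A → ℕ) → ℕ
ΣL []       f = 0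
ΣL (x ∷ xs) f = f x + ΣL xs f

module _ {a} {A : Set a} where

  ΣL-cong : ∀ xs {f g : A → ℕ} → (∀ x → f x ≡ g x) → ΣL xs f ≡ ΣL xs g
  ΣL-cong []       f≡g = refl
  ΣL-cong (x ∷ xs) f≡g = cong₂ _+_ (f≡g x) (ΣL-cong xs f≡g)

  ΣL-++ : ∀ xs ys (f : A → ℕ) → ΣL (xs ++ ys) f ≡ ΣL xs f + ΣL ys f
  ΣL-++ []       ys f = refl
  ΣL-++ (x ∷ xs) ys f = trans (cong (λ s → f x + s) (ΣL-++ xs ys f)) (sym (+-assoc (f x) _ _))

  ΣL-filter : ∀ {p} {P : A → Set p} (P? : ∀ x → Dec (P x)) xs f →
              ΣL (filter P? xs) f ≡ ΣL xs (λ x → χ (P? x) * f x)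
  ΣL-filter P? []       f = refl
  ΣL-filter P? (x ∷ xs) f with P? x
  ... | yes _ = cong₂ _+_ (sym (+-identityʳ (f x))) (ΣL-filter P? xs f)
  ... | no _  = ΣL-filter P? xs f

  length-filter : ∀ {p} {P : A → Set p} (P? : ∀ x → Dec (P x)) xs →
                  length (filter P? xs) ≡ ΣL xs (χ ∘ P?)
  length-filter P? []       = refl
  length-filter P? (x ∷ xs) with P? x
  ... | yes _ = cong suc (length-filter P? xs)
  ... | no _  = length-filter P? xs

ΣL-applyUpTo : ∀ {a} {A : Set a} (h : ℕ → A) n f → ΣL (applyUpTo h n) f ≡ Σ< n (f ∘ h)
ΣL-applyUpTo h zero    f = refl
ΣL-applyUpTo h (suc n) f = trans (cong (λ s → f (h 0) + s) (ΣL-applyUpTo (h ∘ suc) n f)) (sym (Σ<-suc n (f ∘ h)))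

ΣL-range : ∀ N f → ΣL (range N) f ≡ Σ± N f
ΣL-range N f = trans (ΣL-applyUpTo _ (suc (N + N)) f) (Σ<-centred N)
  where
  Σ<-centred : ∀ N → Σ< (suc (N + N)) (λ k → f (+ k ℤ.- + N)) ≡ Σ± N f
  Σ<-centred zero    = refl
  Σ<-centred (suc N) = begin
    Σ< (suc (N + suc N)) G + G (suc (N + suc N))
      ≡⟨ cong (_+ G (suc (N + suc N))) (Σ<-suc (N + suc N) G) ⟩
    G 0 + Σ< (N + suc N) (G ∘ suc) + G (suc (N + suc N))
      ≡⟨ cong₂ (λ m x → G 0 + Σ< m (G ∘ suc) + f x) (+-suc N N) (last (+ N) (+ suc N)) ⟩
    G 0 + Σ< (suc (N + N)) (G ∘ suc) + f (+ suc N)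
      ≡⟨ cong (λ s → G 0 + s + f (+ suc N))
              (trans (Σ<-cong (suc (N + N)) (λ k _ → cong f (step (+ k) (+ N)))) (Σ<-centred N)) ⟩
    f -[1+ N ] + Σ± N f + f (+ suc N) ∎
    where
    open ≡-Reasoning
    G = λ k → f (+ k ℤ.- + suc N)
    last : ∀ a b → + 1 ℤ.+ (a ℤ.+ b) ℤ.- b ≡ + 1 ℤ.+ a
    last = ℤSolver.solve-∀
    step : ∀ a b → + 1 ℤ.+ a ℤ.- (+ 1 ℤ.+ b) ≡ a ℤ.- b
    step = ℤSolver.solve-∀

ΣL-pairs : ∀ {a} {A : Set a} (xs ys : List A) f →
           ΣL (concatMap (λ i → map (λ j → (i , j)) ys) xs) f ≡ ΣL xs (λ i → ΣL ys (λ j → f (i , j)))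
ΣL-pairs []       ys f = refl
ΣL-pairs (x ∷ xs) ys f = trans (ΣL-++ (map (λ j → (x , j)) ys) _ f)
                               (cong₂ _+_ (ΣL-map ys) (ΣL-pairs xs ys f))
  where
  ΣL-map : ∀ ys → ΣL (map (λ j → (x , j)) ys) f ≡ ΣL ys (λ j → f (x , j))
  ΣL-map []       = refl
  ΣL-map (y ∷ ys) = cong (λ s → f (x , y) + s) (ΣL-map ys)

-- Lattice points of a disc

sq : ℤ → ℕ
sq x = ∣ x ∣ * ∣ x ∣

x*x≡+sq : ∀ x → x ℤ.* x ≡ + sq x
x*x≡+sq (+ n)    = ℤP.+◃n≡+n (n * n)
x*x≡+sq -[1+ n ] = ℤP.+◃n≡+n (suc n * suc n)

isqrt : ∀ n → ∃[ r ] (r * r ≤ n × n < suc r * suc r)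
isqrt zero = 0 , z≤n , s≤s z≤n
isqrt (suc n) with isqrt n
... | r , r²≤n , n<[1+r]² with suc r * suc r ≤? suc n
...   | yes [1+r]²≤1+n = suc r , [1+r]²≤1+n , ≤-<-trans n<[1+r]² (*-mono-< (n<1+n (suc r)) (n<1+n (suc r)))
...   | no  [1+r]²≰1+n = r , m≤n⇒m≤1+n r²≤n , ≰⇒> [1+r]²≰1+n

⌊√_⌋ : ℕ → ℕ
⌊√ n ⌋ = proj₁ (isqrt n)

m≤⌊√n⌋⇒m*m≤n : ∀ {m} n → m ≤ ⌊√ n ⌋ → m * m ≤ n
m≤⌊√n⌋⇒m*m≤n n m≤r = ≤-trans (*-mono-≤ m≤r m≤r) (proj₁ (proj₂ (isqrt n)))

m*m≤n⇒m≤⌊√n⌋ : ∀ {m} n → m * m ≤ n → m ≤ ⌊√ n ⌋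
m*m≤n⇒m≤⌊√n⌋ {m} n m²≤n = ≮⇒≥ λ r<m → <⇒≱ (proj₂ (proj₂ (isqrt n))) (≤-trans (*-mono-≤ r<m r<m) m²≤n)

⌊√n⌋≤n : ∀ n → ⌊√ n ⌋ ≤ n
⌊√n⌋≤n n = ≤-trans (m≤m*m ⌊√ n ⌋) (proj₁ (proj₂ (isqrt n)))
  where
  m≤m*m : ∀ m → m ≤ m * m
  m≤m*m zero      = z≤n
  m≤m*m m@(suc _) = m≤m*n m m

InDisc : ℕ → ℤ → ℤ → Set
InDisc R2 i j = (i ℤ.* i ℤ.+ j ℤ.* j) ℤ.≤ + R2

inDisc? : ∀ R2 i j → Dec (InDisc R2 i j)
inDisc? R2 i j = (i ℤ.* i ℤ.+ j ℤ.* j) ℤ.≤? + R2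

radius : ℕ → ℕ
radius R2 = ⌊√ R2 ⌋

width : ℕ → ℤ → ℕ
width R2 i = ⌊√ (R2 ∸ sq i) ⌋

-- The number of rows meeting the disc: the boundary cost of a unit translation of a disc sum.
rowCount : ℕ → ℕ
rowCount R2 = suc (radius R2 + radius R2)

InDisc⇔sq : ∀ R2 i j → InDisc R2 i j ⇔ sq i + sq j ≤ R2
InDisc⇔sq R2 i j rewrite x*x≡+sq i | x*x≡+sq j = mk⇔ ℤP.drop‿+≤+ ℤ.+≤+

sq≤⇔radius×width : ∀ R2 i j → sq i + sq j ≤ R2 ⇔ (∣ i ∣ ≤ radius R2 × ∣ j ∣ ≤ width R2 i)
sq≤⇔radius×width R2 i j = mk⇔ to from
  where
  to : sq i + sq j ≤ R2 → ∣ i ∣ ≤ radius R2 × ∣ j ∣ ≤ width R2 i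
  to le = m*m≤n⇒m≤⌊√n⌋ R2 (m+n≤o⇒m≤o (sq i) le)
        , m*m≤n⇒m≤⌊√n⌋ (R2 ∸ sq i) (m+n≤o⇒m≤o∸n (sq j) (≤-trans (≤-reflexive (+-comm (sq j) (sq i))) le))
  from : ∣ i ∣ ≤ radius R2 × ∣ j ∣ ≤ width R2 i → sq i + sq j ≤ R2
  from (i≤r , j≤w) = ≤-trans (+-monoʳ-≤ (sq i) (m≤⌊√n⌋⇒m*m≤n (R2 ∸ sq i) j≤w))
                             (≤-reflexive (m+[n∸m]≡n (m≤⌊√n⌋⇒m*m≤n R2 i≤r)))

χ-inDisc : ∀ R2 i j → χ (inDisc? R2 i j) ≡ χ (∣ i ∣ ≤? radius R2) * χ (∣ j ∣ ≤? width R2 i)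
χ-inDisc R2 i j = trans (χ-cong (inDisc? R2 i j) (∣ i ∣ ≤? radius R2 ×-dec ∣ j ∣ ≤? width R2 i)
                                (Equivalence.to P⇔Q) (Equivalence.from P⇔Q))
                        (χ-×-dec (∣ i ∣ ≤? radius R2) (∣ j ∣ ≤? width R2 i))
  where
  P⇔Q = ⇔-trans (InDisc⇔sq R2 i j) (sq≤⇔radius×width R2 i j)

Σdisc : ℕ → (ℤ → ℤ → ℕ) → ℕ
Σdisc R2 f = Σ± R2 λ i → Σ± R2 λ j → χ (inDisc? R2 i j) * f i j

module _ (R2 : ℕ) where

  Σdisc-cong : ∀ {f g} → (∀ i j → f i j ≡ g i j) → Σdisc R2 f ≡ Σdisc R2 g
  Σdisc-cong f≡g = Σ±-cong R2 λ i _ → Σ±-cong R2 λ j _ → cong (χ (inDisc? R2 i j) *_) (f≡g i j)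

  Σdisc-mono : ∀ {f g} → (∀ i j → f i j ≤ g i j) → Σdisc R2 f ≤ Σdisc R2 g
  Σdisc-mono f≤g = Σ±-mono R2 λ i _ → Σ±-mono R2 λ j _ → *-monoʳ-≤ (χ (inDisc? R2 i j)) (f≤g i j)

  Σdisc-+ : ∀ f g → Σdisc R2 (λ i j → f i j + g i j) ≡ Σdisc R2 f + Σdisc R2 g
  Σdisc-+ f g = trans (Σ±-cong R2 λ i _ → trans (Σ±-cong R2 λ j _ → *-distribˡ-+ (χ (inDisc? R2 i j)) (f i j) (g i j))
                                                 (Σ±-+ R2 _ _))
                      (Σ±-+ R2 _ _)

  Σdisc-* : ∀ c f → Σdisc R2 (λ i j → c * f i j) ≡ c * Σdisc R2 f
  Σdisc-* c f = trans (Σ±-cong R2 λ i _ → trans (Σ±-cong R2 λ j _ → x*[c*y]≡c*[x*y] (χ (inDisc? R2 i j)) c (f i j))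
                                                 (Σ±-* R2 c _))
                      (Σ±-* R2 c _)
    where
    x*[c*y]≡c*[x*y] : ∀ x c y → x * (c * y) ≡ c * (x * y)
    x*[c*y]≡c*[x*y] = solve-∀

  Σdisc-+₃ : ∀ f g h → Σdisc R2 (λ i j → f i j + g i j + h i j) ≡ Σdisc R2 f + Σdisc R2 g + Σdisc R2 h
  Σdisc-+₃ f g h = trans (Σdisc-+ _ h) (cong (_+ Σdisc R2 h) (Σdisc-+ f g))

  Σdisc-+₄ : ∀ f g h k → Σdisc R2 (λ i j → f i j + g i j + h i j + k i j) ≡
                         Σdisc R2 f + Σdisc R2 g + Σdisc R2 h + Σdisc R2 k
  Σdisc-+₄ f g h k = trans (Σdisc-+ _ k) (cong (_+ Σdisc R2 k) (Σdisc-+₃ f g h))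

  Σdisc-Σ< : ∀ n (f : ℤ → ℤ → ℕ → ℕ) → Σdisc R2 (λ i j → Σ< n (f i j)) ≡ Σ< n (λ k → Σdisc R2 (λ i j → f i j k))
  Σdisc-Σ< zero    f = Σdisc-* 0 (λ _ _ → 0)
  Σdisc-Σ< (suc n) f = trans (Σdisc-+ (λ i j → Σ< n (f i j)) (λ i j → f i j n))
                             (cong (_+ Σdisc R2 (λ i j → f i j n)) (Σdisc-Σ< n f))

  Σdisc-rows : ∀ f → Σdisc R2 f ≡ Σ± (radius R2) (λ i → Σ± (width R2 i) (f i))
  Σdisc-rows f = begin
    Σdisc R2 f
      ≡⟨ (Σ±-cong R2 λ i _ → Σ±-cong R2 λ j _ →
            trans (cong (_* f i j) (χ-inDisc R2 i j)) (*-assoc (χ (∣ i ∣ ≤? r)) _ (f i j))) ⟩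
    Σ± R2 (λ i → Σ± R2 (λ j → χ (∣ i ∣ ≤? r) * (χ (∣ j ∣ ≤? width R2 i) * f i j)))
      ≡⟨ (Σ±-cong R2 λ i _ → trans (Σ±-* R2 (χ (∣ i ∣ ≤? r)) _)
                                    (cong (χ (∣ i ∣ ≤? r) *_) (Σ±-restrict R2 (f i) (width≤R2 i)))) ⟩
    Σ± R2 (λ i → χ (∣ i ∣ ≤? r) * Σ± (width R2 i) (f i))
      ≡⟨ Σ±-restrict R2 _ (⌊√n⌋≤n R2) ⟩
    Σ± r (λ i → Σ± (width R2 i) (f i)) ∎
    where
    open ≡-Reasoning
    r = radius R2
    width≤R2 : ∀ i → width R2 i ≤ R2
    width≤R2 i = ≤-trans (⌊√n⌋≤n (R2 ∸ sq i)) (m∸n≤m R2 (sq i))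

  Σdisc-transpose : ∀ f → Σdisc R2 f ≡ Σdisc R2 (λ i j → f j i)
  Σdisc-transpose f = trans (Σ±-swap R2 R2 _)
    (Σ±-cong R2 λ i _ → Σ±-cong R2 λ j _ → cong (_* f j i) (χ-cong (inDisc? R2 j i) (inDisc? R2 i j) (swap {j} {i}) (swap {i} {j})))
    where
    swap : ∀ {x y} → InDisc R2 x y → InDisc R2 y x
    swap {x} {y} = subst (ℤ._≤ + R2) (ℤP.+-comm (x ℤ.* x) (y ℤ.* y))

row-translate⁺ : ∀ s h → (∀ k → h k ≤ 1) → Σ± s h ≤ Σ± s (λ k → h (k ℤ.+ + 1)) + 1
row-translate⁺ s h h≤1 = begin
  Σ± s h                                   ≤⟨ m≤m+n (Σ± s h) (h (+ suc s)) ⟩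
  Σ± s h + h (+ suc s)                     ≡⟨ Σ±-translate s h ⟨
  Σ± s (λ k → h (k ℤ.+ + 1)) + h (ℤ.- + s) ≤⟨ +-monoʳ-≤ _ (h≤1 (ℤ.- + s)) ⟩
  Σ± s (λ k → h (k ℤ.+ + 1)) + 1           ∎
  where open ≤-Reasoning

row-translate⁻ : ∀ s h → (∀ k → h k ≤ 1) → Σ± s h ≤ Σ± s (λ k → h (k ℤ.- + 1)) + 1
row-translate⁻ s h h≤1 = begin
  Σ± s h                                              ≡⟨ Σ±-cong s (λ k _ → cong h (k+1-1≡k k)) ⟨
  Σ± s (λ k → h (k ℤ.+ + 1 ℤ.- + 1))                  ≤⟨ m≤m+n _ _ ⟩
  Σ± s (λ k → h (k ℤ.+ + 1 ℤ.- + 1)) + h (ℤ.- + s ℤ.- + 1) ≡⟨ Σ±-translate s (λ k → h (k ℤ.- + 1)) ⟩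
  Σ± s (λ k → h (k ℤ.- + 1)) + h (+ suc s ℤ.- + 1)    ≤⟨ +-monoʳ-≤ _ (h≤1 _) ⟩
  Σ± s (λ k → h (k ℤ.- + 1)) + 1                      ∎
  where
  open ≤-Reasoning
  k+1-1≡k : ∀ k → k ℤ.+ + 1 ℤ.- + 1 ≡ k
  k+1-1≡k = ℤSolver.solve-∀

Bounded : (ℤ → ℤ → ℕ) → Set
Bounded g = ∀ i j → g i j ≤ 1

module _ (R2 : ℕ) where

  Σdisc-by-rows : ∀ {f g} → (∀ i s → Σ± s (f i) ≤ Σ± s (g i) + 1) → Σdisc R2 f ≤ Σdisc R2 g + rowCount R2
  Σdisc-by-rows {f} {g} row≤ = begin
    Σdisc R2 f                                         ≡⟨ Σdisc-rows R2 f ⟩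
    Σ± r (λ i → Σ± (width R2 i) (f i))                 ≤⟨ Σ±-mono r (λ i _ → row≤ i (width R2 i)) ⟩
    Σ± r (λ i → Σ± (width R2 i) (g i) + 1)             ≡⟨ Σ±-+ r _ _ ⟩
    Σ± r (λ i → Σ± (width R2 i) (g i)) + Σ± r (λ _ → 1)
      ≡⟨ cong₂ _+_ (sym (Σdisc-rows R2 g)) (trans (Σ±-const r 1) (*-identityʳ _)) ⟩
    Σdisc R2 g + rowCount R2                               ∎
    where
    open ≤-Reasoning
    r = radius R2

  Σdisc-translateʲ⁺ : ∀ n g → Bounded g →
                      Σdisc R2 g ≤ Σdisc R2 (λ i j → g i (j ℤ.+ + n)) + n * rowCount R2
  Σdisc-translateʲ⁺ zero    g g≤1 = ≤-reflexive (trans (Σdisc-cong R2 λ i j → cong (g i) (sym (ℤP.+-identityʳ j)))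
                                                        (sym (+-identityʳ _)))
  Σdisc-translateʲ⁺ (suc n) g g≤1 = begin
    Σdisc R2 g
      ≤⟨ Σdisc-translateʲ⁺ n g g≤1 ⟩
    Σdisc R2 (λ i j → g i (j ℤ.+ + n)) + n * rowCount R2
      ≤⟨ +-monoˡ-≤ _ (Σdisc-by-rows λ i s → row-translate⁺ s (λ j → g i (j ℤ.+ + n)) (λ j → g≤1 i _)) ⟩
    Σdisc R2 (λ i j → g i (j ℤ.+ + 1 ℤ.+ + n)) + rowCount R2 + n * rowCount R2
      ≡⟨ +-assoc _ (rowCount R2) _ ⟩
    Σdisc R2 (λ i j → g i (j ℤ.+ + 1 ℤ.+ + n)) + suc n * rowCount R2
      ≡⟨ cong (_+ _) (Σdisc-cong R2 λ i j → cong (g i) (j+1+n≡j+[1+n] j (+ n))) ⟩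
    Σdisc R2 (λ i j → g i (j ℤ.+ + suc n)) + suc n * rowCount R2 ∎
    where
    open ≤-Reasoning
    j+1+n≡j+[1+n] : ∀ j n → j ℤ.+ + 1 ℤ.+ n ≡ j ℤ.+ (+ 1 ℤ.+ n)
    j+1+n≡j+[1+n] = ℤSolver.solve-∀

  Σdisc-translateʲ⁻ : ∀ n g → Bounded g →
                      Σdisc R2 g ≤ Σdisc R2 (λ i j → g i (j ℤ.+ -[1+ n ])) + suc n * rowCount R2
  Σdisc-translateʲ⁻ zero    g g≤1 = ≤-trans (Σdisc-by-rows λ i s → row-translate⁻ s (g i) (g≤1 i))
                                            (≤-reflexive (cong (ℕ._+_ _) (sym (+-identityʳ (rowCount R2)))))
  Σdisc-translateʲ⁻ (suc n) g g≤1 = begin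
    Σdisc R2 g
      ≤⟨ Σdisc-translateʲ⁻ n g g≤1 ⟩
    Σdisc R2 (λ i j → g i (j ℤ.+ -[1+ n ])) + suc n * rowCount R2
      ≤⟨ +-monoˡ-≤ _ (Σdisc-by-rows λ i s → row-translate⁻ s (λ j → g i (j ℤ.+ -[1+ n ])) (λ j → g≤1 i _)) ⟩
    Σdisc R2 (λ i j → g i (j ℤ.- + 1 ℤ.+ -[1+ n ])) + rowCount R2 + suc n * rowCount R2
      ≡⟨ +-assoc _ (rowCount R2) _ ⟩
    Σdisc R2 (λ i j → g i (j ℤ.- + 1 ℤ.+ -[1+ n ])) + suc (suc n) * rowCount R2
      ≡⟨ cong (_+ _) (Σdisc-cong R2 λ i j → cong (g i) (j-1-[1+n]≡j-[2+n] j (+ n))) ⟩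
    Σdisc R2 (λ i j → g i (j ℤ.+ -[1+ suc n ])) + suc (suc n) * rowCount R2 ∎
    where
    open ≤-Reasoning
    j-1-[1+n]≡j-[2+n] : ∀ j n → j ℤ.- + 1 ℤ.+ ℤ.- (+ 1 ℤ.+ n) ≡ j ℤ.+ ℤ.- (+ 1 ℤ.+ (+ 1 ℤ.+ n))
    j-1-[1+n]≡j-[2+n] = ℤSolver.solve-∀

  Σdisc-translateʲ : ∀ b g → Bounded g →
                     Σdisc R2 g ≤ Σdisc R2 (λ i j → g i (j ℤ.+ b)) + ∣ b ∣ * rowCount R2
  Σdisc-translateʲ (+ n)    = Σdisc-translateʲ⁺ n
  Σdisc-translateʲ -[1+ n ] = Σdisc-translateʲ⁻ n

  Σdisc-translateⁱ : ∀ a g → Bounded g →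
                     Σdisc R2 g ≤ Σdisc R2 (λ i j → g (i ℤ.+ a) j) + ∣ a ∣ * rowCount R2
  Σdisc-translateⁱ a g g≤1 = begin
    Σdisc R2 g                                             ≡⟨ Σdisc-transpose R2 g ⟩
    Σdisc R2 (λ i j → g j i)                               ≤⟨ Σdisc-translateʲ a (λ i j → g j i) (λ i j → g≤1 j i) ⟩
    Σdisc R2 (λ i j → g (j ℤ.+ a) i) + ∣ a ∣ * rowCount R2 ≡⟨ cong (_+ _) (Σdisc-transpose R2 (λ i j → g (i ℤ.+ a) j)) ⟨
    Σdisc R2 (λ i j → g (i ℤ.+ a) j) + ∣ a ∣ * rowCount R2 ∎
    where open ≤-Reasoning

  Σdisc-translate : ∀ {g h} a b → Bounded g → (∀ i j → h i j ≡ g (i ℤ.+ a) (j ℤ.+ b)) →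
                    Σdisc R2 g ≤ Σdisc R2 h + (∣ a ∣ + ∣ b ∣) * rowCount R2
  Σdisc-translate {g} {h} a b g≤1 h≡g∘τ = begin
    Σdisc R2 g
      ≤⟨ Σdisc-translateⁱ a g g≤1 ⟩
    Σdisc R2 (λ i j → g (i ℤ.+ a) j) + ∣ a ∣ * rowCount R2
      ≤⟨ +-monoˡ-≤ _ (Σdisc-translateʲ b (λ i j → g (i ℤ.+ a) j) (λ i j → g≤1 _ j)) ⟩
    Σdisc R2 (λ i j → g (i ℤ.+ a) (j ℤ.+ b)) + ∣ b ∣ * rowCount R2 + ∣ a ∣ * rowCount R2
      ≡⟨ +-assoc (Σdisc R2 (λ i j → g (i ℤ.+ a) (j ℤ.+ b))) (∣ b ∣ * rowCount R2) _ ⟩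
    Σdisc R2 (λ i j → g (i ℤ.+ a) (j ℤ.+ b)) + (∣ b ∣ * rowCount R2 + ∣ a ∣ * rowCount R2)
      ≡⟨ cong₂ _+_ (Σdisc-cong R2 λ i j → sym (h≡g∘τ i j)) (+-comm (∣ b ∣ * rowCount R2) _) ⟩
    Σdisc R2 h + (∣ a ∣ * rowCount R2 + ∣ b ∣ * rowCount R2)
      ≡⟨ cong (ℕ._+_ (Σdisc R2 h)) (*-distribʳ-+ (rowCount R2) ∣ a ∣ ∣ b ∣) ⟨
    Σdisc R2 h + (∣ a ∣ + ∣ b ∣) * rowCount R2 ∎
    where open ≤-Reasoning

box : ℕ → List (ℤ × ℤ)
box N = concatMap (λ i → map (λ j → (i , j)) (range N)) (range N)

ΣL-box : ∀ N f → ΣL (box N) f ≡ Σ± N (λ i → Σ± N (λ j → f (i , j)))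
ΣL-box N f = trans (ΣL-pairs (range N) (range N) f)
                   (trans (ΣL-cong (range N) (λ i → ΣL-range N (λ j → f (i , j)))) (ΣL-range N _))

discCount≡Σdisc : ∀ R2 → discCount R2 ≡ Σdisc R2 (λ _ _ → 1)
discCount≡Σdisc R2 = trans (length-filter (λ p → inDisc? R2 (proj₁ p) (proj₂ p)) (box R2))
  (trans (ΣL-box R2 _) (Σ±-cong R2 λ i _ → Σ±-cong R2 λ j _ → sym (*-identityʳ (χ (inDisc? R2 i j)))))

wildCount≡Σdisc : ∀ M R2 → wildCount M R2 ≡ Σdisc R2 (λ i j → χ (wild? M i j))
wildCount≡Σdisc M R2 = trans (length-filter (λ p → wild? M (proj₁ p) (proj₂ p)) (disc R2))
                              (trans (ΣL-filter (λ p → inDisc? R2 (proj₁ p) (proj₂ p)) (box R2) _) (ΣL-box R2 _))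

square≤Σdisc : ∀ R2 t → t * t + t * t ≤ R2 → suc (t + t) * suc (t + t) ≤ Σdisc R2 (λ _ _ → 1)
square≤Σdisc R2 t 2t²≤R2 = begin
  suc (t + t) * suc (t + t)                       ≡⟨ cong (suc (t + t) *_) (trans (Σ±-const t 1) (*-identityʳ _)) ⟨
  suc (t + t) * Σ± t (λ _ → 1)                    ≡⟨ Σ±-const t (Σ± t (λ _ → 1)) ⟨
  Σ± t (λ _ → Σ± t (λ _ → 1))                     ≤⟨ Σ±-mono t (λ i i≤t → Σ±-mono-radius (λ _ → 1) (t≤width i i≤t)) ⟩
  Σ± t (λ i → Σ± (width R2 i) (λ _ → 1))          ≤⟨ Σ±-mono-radius _ t≤radius ⟩
  Σ± (radius R2) (λ i → Σ± (width R2 i) (λ _ → 1)) ≡⟨ Σdisc-rows R2 _ ⟨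
  Σdisc R2 (λ _ _ → 1)                            ∎
  where
  open ≤-Reasoning
  t≤radius : t ≤ radius R2
  t≤radius = m*m≤n⇒m≤⌊√n⌋ R2 (m+n≤o⇒m≤o (t * t) 2t²≤R2)
  t≤width : ∀ i → ∣ i ∣ ≤ t → t ≤ width R2 i
  t≤width i i≤t = m*m≤n⇒m≤⌊√n⌋ (R2 ∸ sq i)
                    (m+n≤o⇒m≤o∸n (t * t) (≤-trans (+-monoʳ-≤ (t * t) (*-mono-≤ i≤t i≤t)) 2t²≤R2))

⌈n/2⌉≤1+⌊n/2⌋ : ∀ n → ⌈ n /2⌉ ≤ suc ⌊ n /2⌋
⌈n/2⌉≤1+⌊n/2⌋ zero          = z≤n
⌈n/2⌉≤1+⌊n/2⌋ (suc zero)    = s≤s z≤n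
⌈n/2⌉≤1+⌊n/2⌋ (suc (suc n)) = s≤s (⌈n/2⌉≤1+⌊n/2⌋ n)

rowCount-negligible : ∀ k → ∃[ N ] ∀ R2 → N ≤ R2 → k * rowCount R2 ≤ discCount R2
rowCount-negligible k = 3 * k * (3 * k) , bound
  where
  bound : ∀ R2 → 3 * k * (3 * k) ≤ R2 → k * rowCount R2 ≤ discCount R2
  bound R2 9k²≤R2 = begin
    k * suc (r + r)               ≤⟨ *-monoʳ-≤ k (s≤s (+-mono-≤ r≤u r≤u)) ⟩
    k * suc (u + u)               ≤⟨ *-monoʳ-≤ k 1+2u≤3u ⟩
    k * (3 * u)                   ≡⟨ k*[3*u]≡3*k*u k u ⟩
    3 * k * u                     ≤⟨ *-monoˡ-≤ u (≤-trans 3k≤r r≤u) ⟩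
    u * u                         ≤⟨ square≤Σdisc R2 t 2t²≤R2 ⟩
    Σdisc R2 (λ _ _ → 1)          ≡⟨ discCount≡Σdisc R2 ⟨
    discCount R2                  ∎
    where
    open ≤-Reasoning
    r = radius R2
    t = ⌊ r /2⌋
    u = suc (t + t)
    k*[3*u]≡3*k*u : ∀ k u → k * (3 * u) ≡ 3 * k * u
    k*[3*u]≡3*k*u = solve-∀
    t²+t²+[t²+t²]≡[t+t]² : ∀ t → t * t + t * t + (t * t + t * t) ≡ (t + t) * (t + t)
    t²+t²+[t²+t²]≡[t+t]² = solve-∀
    3[1+v]≡1+2[1+v]+v : ∀ v → suc (suc v + suc v) + v ≡ 3 * suc v
    3[1+v]≡1+2[1+v]+v = solve-∀
    3k≤r : 3 * k ≤ r
    3k≤r = m*m≤n⇒m≤⌊√n⌋ R2 9k²≤R2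
    t+t≤r : t + t ≤ r
    t+t≤r = ≤-trans (+-monoʳ-≤ t (⌊n/2⌋≤⌈n/2⌉ r)) (≤-reflexive (⌊n/2⌋+⌈n/2⌉≡n r))
    r≤u : r ≤ u
    r≤u = ≤-trans (≤-reflexive (sym (⌊n/2⌋+⌈n/2⌉≡n r)))
                  (≤-trans (+-monoʳ-≤ t (⌈n/2⌉≤1+⌊n/2⌋ r)) (≤-reflexive (+-suc t t)))
    2t²≤R2 : t * t + t * t ≤ R2
    2t²≤R2 = ≤-trans (≤-trans (m≤m+n _ (t * t + t * t)) (≤-reflexive (t²+t²+[t²+t²]≡[t+t]² t)))
                     (≤-trans (*-mono-≤ t+t≤r t+t≤r) (proj₁ (proj₂ (isqrt R2))))
    1+2u≤3u : suc (u + u) ≤ 3 * u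
    1+2u≤3u = ≤-trans (m≤m+n (suc (u + u)) (t + t)) (≤-reflexive (3[1+v]≡1+2[1+v]+v (t + t)))

-- 3×3 windows of SL₂-tilings

record UnitMinors (a b c d e f g h k : ℤ) : Set where
  field
    ↖ : a ℤ.* e ℤ.- b ℤ.* d ≡ + 1
    ↗ : b ℤ.* f ℤ.- c ℤ.* e ≡ + 1
    ↙ : d ℤ.* h ℤ.- e ℤ.* g ≡ + 1
    ↘ : e ℤ.* k ℤ.- f ℤ.* h ≡ + 1

dodgson : ∀ a b c d e f g h k →
  det3 a b c d e f g h k ℤ.* e ≡
  (e ℤ.* k ℤ.- f ℤ.* h) ℤ.* (a ℤ.* e ℤ.- b ℤ.* d) ℤ.- (d ℤ.* h ℤ.- e ℤ.* g) ℤ.* (b ℤ.* f ℤ.- c ℤ.* e)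
dodgson = polynomial-identity
  where
  polynomial-identity : ∀ a b c d e f g h k →
    (a ℤ.* (e ℤ.* k ℤ.- f ℤ.* h) ℤ.- b ℤ.* (d ℤ.* k ℤ.- f ℤ.* g) ℤ.+ c ℤ.* (d ℤ.* h ℤ.- e ℤ.* g)) ℤ.* e ≡
    (e ℤ.* k ℤ.- f ℤ.* h) ℤ.* (a ℤ.* e ℤ.- b ℤ.* d) ℤ.- (d ℤ.* h ℤ.- e ℤ.* g) ℤ.* (b ℤ.* f ℤ.- c ℤ.* e)
  polynomial-identity = ℤSolver.solve-∀

det3≡0∨centre≡0 : ∀ {a b c d e f g h k} → UnitMinors a b c d e f g h k → det3 a b c d e f g h k ≡ + 0 ⊎ e ≡ + 0
det3≡0∨centre≡0 {a} {b} {c} {d} {e} {f} {g} {h} {k} m = ℤP.i*j≡0⇒i≡0∨j≡0 (det3 a b c d e f g h k)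
  (trans (dodgson a b c d e f g h k) (cong₂ ℤ._-_ (cong₂ ℤ._*_ ↘ ↖) (cong₂ ℤ._*_ ↙ ↗)))
  where open UnitMinors m

det3-zero-centre : ∀ {a b c d e f g h k} → UnitMinors a b c d e f g h k → e ≡ + 0 →
                   det3 a b c d e f g h k ≡ a ℤ.+ c ℤ.+ g ℤ.+ k
det3-zero-centre {a} {b} {c} {d} {f = f} {g} {h} {k} m refl = begin
  det3 a b c d (+ 0) f g h k
    ≡⟨ cofactors a b c d f g h k ⟩
  a ℤ.* (+ 0 ℤ.* k ℤ.- f ℤ.* h) ℤ.+ k ℤ.* (a ℤ.* + 0 ℤ.- b ℤ.* d)
    ℤ.+ g ℤ.* (b ℤ.* f ℤ.- c ℤ.* + 0) ℤ.+ c ℤ.* (d ℤ.* h ℤ.- + 0 ℤ.* g)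
    ≡⟨ cong₂ ℤ._+_ (cong₂ ℤ._+_ (cong₂ ℤ._+_ (cong (a ℤ.*_) ↘) (cong (k ℤ.*_) ↖)) (cong (g ℤ.*_) ↗))
                   (cong (c ℤ.*_) ↙) ⟩
  a ℤ.* + 1 ℤ.+ k ℤ.* + 1 ℤ.+ g ℤ.* + 1 ℤ.+ c ℤ.* + 1
    ≡⟨ collect a c g k ⟩
  a ℤ.+ c ℤ.+ g ℤ.+ k ∎
  where
  open ≡-Reasoning
  open UnitMinors m
  cofactors : ∀ a b c d f g h k →
    a ℤ.* (+ 0 ℤ.* k ℤ.- f ℤ.* h) ℤ.- b ℤ.* (d ℤ.* k ℤ.- f ℤ.* g) ℤ.+ c ℤ.* (d ℤ.* h ℤ.- + 0 ℤ.* g) ≡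
    a ℤ.* (+ 0 ℤ.* k ℤ.- f ℤ.* h) ℤ.+ k ℤ.* (a ℤ.* + 0 ℤ.- b ℤ.* d)
      ℤ.+ g ℤ.* (b ℤ.* f ℤ.- c ℤ.* + 0) ℤ.+ c ℤ.* (d ℤ.* h ℤ.- + 0 ℤ.* g)
  cofactors = ℤSolver.solve-∀
  collect : ∀ a c g k → a ℤ.* + 1 ℤ.+ k ℤ.* + 1 ℤ.+ g ℤ.* + 1 ℤ.+ c ℤ.* + 1 ≡ a ℤ.+ c ℤ.+ g ℤ.+ k
  collect = ℤSolver.solve-∀

minor-zero-row : ∀ {a c} b d → a ≡ + 0 → c ≡ + 0 → a ℤ.* b ℤ.- c ℤ.* d ≡ + 0
minor-zero-row b d refl refl = refl

minor-zero-col : ∀ {a d} b c → a ≡ + 0 → d ≡ + 0 → a ℤ.* b ℤ.- c ℤ.* d ≡ + 0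
minor-zero-col b c refl refl = cong (ℤ._-_ (+ 0)) (ℤP.*-zeroʳ c)

+0≢+1 : + 0 ≢ + 1
+0≢+1 ()

module SL2Tiling {M : Array} (T : IsSL2Tiling M) where

  minor : ∀ {i i′ j j′} → i ℤ.+ + 1 ≡ i′ → j ℤ.+ + 1 ≡ j′ → M i j ℤ.* M i′ j′ ℤ.- M i j′ ℤ.* M i′ j ≡ + 1
  minor {i} {j = j} i+1≡i′ j+1≡j′ = subst₂ (λ x y → M i j ℤ.* M x y ℤ.- M i y ℤ.* M x j ≡ + 1) i+1≡i′ j+1≡j′ (T i j)

  unit-minors : ∀ i j → UnitMinors (M (i ℤ.- + 1) (j ℤ.- + 1)) (M (i ℤ.- + 1) j) (M (i ℤ.- + 1) (j ℤ.+ + 1))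
                                 (M i (j ℤ.- + 1))         (M i j)         (M i (j ℤ.+ + 1))
                                 (M (i ℤ.+ + 1) (j ℤ.- + 1)) (M (i ℤ.+ + 1) j) (M (i ℤ.+ + 1) (j ℤ.+ + 1))
  unit-minors i j = record
    { ↖ = minor {i ℤ.- + 1} {i} {j ℤ.- + 1} {j} (k-1+1≡k i) (k-1+1≡k j)
    ; ↗ = minor {i ℤ.- + 1} {i} {j} {j ℤ.+ + 1} (k-1+1≡k i) refl
    ; ↙ = minor {i} {i ℤ.+ + 1} {j ℤ.- + 1} {j} refl (k-1+1≡k j)
    ; ↘ = T i j
    }
    where
    k-1+1≡k : ∀ k → k ℤ.- + 1 ℤ.+ + 1 ≡ k
    k-1+1≡k = ℤSolver.solve-∀

  wild⇒zero : ∀ {i j} → Wild M i j → M i j ≡ + 0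
  wild⇒zero {i} {j} wild = [ flip contradiction wild , id ] (det3≡0∨centre≡0 (unit-minors i j))

  centredDet-at-zero : ∀ {i j} → M i j ≡ + 0 →
    centredDet M i j ≡ M (i ℤ.- + 1) (j ℤ.- + 1) ℤ.+ M (i ℤ.- + 1) (j ℤ.+ + 1)
                   ℤ.+ M (i ℤ.+ + 1) (j ℤ.- + 1) ℤ.+ M (i ℤ.+ + 1) (j ℤ.+ + 1)
  centredDet-at-zero {i} {j} = det3-zero-centre (unit-minors i j)

  ¬wild-pairʰ : ∀ {i j} → Wild M i j → ¬ Wild M i (j ℤ.+ + 1)
  ¬wild-pairʰ {i} {j} w w′ =
    +0≢+1 (trans (sym (minor-zero-row (M (i ℤ.+ + 1) (j ℤ.+ + 1)) (M (i ℤ.+ + 1) j) (wild⇒zero w) (wild⇒zero w′))) (T i j))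

  ¬wild-pairᵛ : ∀ {i j} → Wild M i j → ¬ Wild M (i ℤ.+ + 1) j
  ¬wild-pairᵛ {i} {j} w w′ =
    +0≢+1 (trans (sym (minor-zero-col (M (i ℤ.+ + 1) (j ℤ.+ + 1)) (M i (j ℤ.+ + 1)) (wild⇒zero w) (wild⇒zero w′))) (T i j))

  ¬wild-quincunx : ∀ {i j} → Wild M i j →
                   Wild M (i ℤ.- + 1) (j ℤ.- + 1) → Wild M (i ℤ.- + 1) (j ℤ.+ + 1) →
                   Wild M (i ℤ.+ + 1) (j ℤ.- + 1) → Wild M (i ℤ.+ + 1) (j ℤ.+ + 1) → ⊥
  ¬wild-quincunx w w₁ w₂ w₃ w₄ =
    w (trans (centredDet-at-zero (wild⇒zero w))
             (cong₂ ℤ._+_ (cong₂ ℤ._+_ (cong₂ ℤ._+_ (wild⇒zero w₁) (wild⇒zero w₂)) (wild⇒zero w₃)) (wild⇒zero w₄)))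

-- The upper bound

χ-block : ∀ {p q r s} {A : Set p} {B : Set q} {C : Set r} {D : Set s}
          (a : Dec A) (b : Dec B) (c : Dec C) (d : Dec D) →
          (A → ¬ B) → (A → ¬ C) → (B → ¬ D) → (C → ¬ D) →
          χ a + χ b + χ c + χ d ≤ 1 + χ a * χ d + χ b * χ c
χ-block (yes a) (yes b) _       _       a⊥b _   _   _   = contradiction b (a⊥b a)
χ-block (yes a) (no _)  (yes c) _       _   a⊥c _   _   = contradiction c (a⊥c a)
χ-block (no _)  (yes b) _       (yes d) _   _   b⊥d _   = contradiction d (b⊥d b)
χ-block (no _)  (no _)  (yes c) (yes d) _   _   _   c⊥d = contradiction d (c⊥d c)
χ-block (yes _) (no _)  (no _)  (yes _) _   _   _   _   = ≤-refl
χ-block (yes _) (no _)  (no _)  (no _)  _   _   _   _   = ≤-refl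
χ-block (no _)  (yes _) (yes _) (no _)  _   _   _   _   = ≤-refl
χ-block (no _)  (yes _) (no _)  (no _)  _   _   _   _   = ≤-refl
χ-block (no _)  (no _)  (yes _) (no _)  _   _   _   _   = ≤-refl
χ-block (no _)  (no _)  (no _)  (yes _) _   _   _   _   = ≤-refl
χ-block (no _)  (no _)  (no _)  (no _)  _   _   _   _   = z≤n

χ-not-all : ∀ {p q r s} {A : Set p} {B : Set q} {C : Set r} {D : Set s}
            (a : Dec A) (b : Dec B) (c : Dec C) (d : Dec D) →
            (A → B → C → D → ⊥) → χ a + χ b + χ c + χ d ≤ 3
χ-not-all (no _)  b       c       d       _ = +-mono-≤ (+-mono-≤ (χ≤1 b) (χ≤1 c)) (χ≤1 d)
χ-not-all (yes _) (no _)  c       d       _ = s≤s (+-mono-≤ (χ≤1 c) (χ≤1 d))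
χ-not-all (yes _) (yes _) (no _)  d       _ = s≤s (s≤s (χ≤1 d))
χ-not-all (yes _) (yes _) (yes _) (no _)  _ = ≤-refl
χ-not-all (yes a) (yes b) (yes c) (yes d) ⊥ = contradiction d (⊥ a b c)

χ-star : ∀ {p q r s t} {E : Set p} {A : Set q} {B : Set r} {C : Set s} {D : Set t}
         (e : Dec E) (a : Dec A) (b : Dec B) (c : Dec C) (d : Dec D) →
         (E → A → B → C → D → ⊥) →
         χ e * χ a + χ b * χ e + χ e * χ c + χ d * χ e ≤ 3 * χ e
χ-star (no _)  _ b _ d _ rewrite *-zeroʳ (χ b) | *-zeroʳ (χ d) = z≤n
χ-star (yes e) a b c d ⊥ = ≤-trans (≤-reflexive (unit (χ a) (χ b) (χ c) (χ d))) (χ-not-all a b c d (⊥ e))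
  where
  unit : ∀ a b c d → 1 * a + b * 1 + 1 * c + d * 1 ≡ a + b + c + d
  unit = solve-∀

module UpperBound {M : Array} (T : IsSL2Tiling M) (R2 : ℕ) where

  open SL2Tiling {M} T

  w : ℤ → ℤ → ℕ
  w i j = χ (wild? M i j)

  w≤1 : Bounded w
  w≤1 i j = χ≤1 (wild? M i j)

  diag anti : ℤ → ℤ → ℕ
  diag i j = w i j * w (i ℤ.+ + 1) (j ℤ.+ + 1)
  anti i j = w (i ℤ.+ + 1) j * w i (j ℤ.+ + 1)

  diag≤1 : Bounded diag
  diag≤1 i j = *-mono-≤ (w≤1 i j) (w≤1 _ _)

  anti≤1 : Bounded anti
  anti≤1 i j = *-mono-≤ (w≤1 _ _) (w≤1 _ _)

  block≤ : ∀ i j → w i j + w (i ℤ.+ + 1) j + w i (j ℤ.+ + 1) + w (i ℤ.+ + 1) (j ℤ.+ + 1) ≤ 1 + diag i j + anti i j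
  block≤ i j = χ-block (wild? M i j) (wild? M (i ℤ.+ + 1) j) (wild? M i (j ℤ.+ + 1)) (wild? M (i ℤ.+ + 1) (j ℤ.+ + 1))
                       ¬wild-pairᵛ ¬wild-pairʰ ¬wild-pairʰ ¬wild-pairᵛ

  star≤ : ∀ i j → w i j * w (i ℤ.+ + 1) (j ℤ.+ + 1) + w (i ℤ.- + 1) (j ℤ.- + 1) * w i j
                + w i j * w (i ℤ.- + 1) (j ℤ.+ + 1) + w (i ℤ.+ + 1) (j ℤ.- + 1) * w i j ≤ 3 * w i j
  star≤ i j = χ-star (wild? M i j) (wild? M (i ℤ.+ + 1) (j ℤ.+ + 1)) (wild? M (i ℤ.- + 1) (j ℤ.- + 1))
                     (wild? M (i ℤ.- + 1) (j ℤ.+ + 1)) (wild? M (i ℤ.+ + 1) (j ℤ.- + 1))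
                     (λ centre ↘ ↖ ↗ ↙ → ¬wild-quincunx centre ↖ ↗ ↙ ↘)

  A D R L e : ℕ
  A = Σdisc R2 w
  D = Σdisc R2 (λ _ _ → 1)
  R = Σdisc R2 diag
  L = Σdisc R2 anti
  e = rowCount R2

  block-count : 4 * A ≤ D + R + L + 4 * e
  block-count = begin
    4 * A                    ≡⟨ 4*a≡a+a+a+a A ⟩
    A + A + A + A            ≤⟨ +-mono-≤ (+-mono-≤ (+-monoʳ-≤ A down) right) down-right ⟩
    A + (X₁ + 1 * e) + (X₂ + 1 * e) + (X₃ + 2 * e) ≡⟨ collect A X₁ X₂ X₃ e ⟩
    A + X₁ + X₂ + X₃ + 4 * e ≡⟨ cong (_+ 4 * e) (Σdisc-+₄ R2 w _ _ _) ⟨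
    Σdisc R2 (λ i j → w i j + w (i ℤ.+ + 1) j + w i (j ℤ.+ + 1) + w (i ℤ.+ + 1) (j ℤ.+ + 1)) + 4 * e
      ≤⟨ +-monoˡ-≤ (4 * e) (Σdisc-mono R2 block≤) ⟩
    Σdisc R2 (λ i j → 1 + diag i j + anti i j) + 4 * e ≡⟨ cong (_+ 4 * e) (Σdisc-+₃ R2 _ diag anti) ⟩
    D + R + L + 4 * e ∎
    where
    open ≤-Reasoning
    X₁ = Σdisc R2 (λ i j → w (i ℤ.+ + 1) j)
    X₂ = Σdisc R2 (λ i j → w i (j ℤ.+ + 1))
    X₃ = Σdisc R2 (λ i j → w (i ℤ.+ + 1) (j ℤ.+ + 1))
    down : A ≤ X₁ + 1 * e
    down = Σdisc-translate R2 (+ 1) (+ 0) w≤1 (λ i j → cong (w _) (sym (ℤP.+-identityʳ j)))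
    right : A ≤ X₂ + 1 * e
    right = Σdisc-translate R2 (+ 0) (+ 1) w≤1 (λ i j → cong (λ x → w x _) (sym (ℤP.+-identityʳ i)))
    down-right : A ≤ X₃ + 2 * e
    down-right = Σdisc-translate R2 (+ 1) (+ 1) w≤1 (λ i j → refl)
    4*a≡a+a+a+a : ∀ a → 4 * a ≡ a + a + a + a
    4*a≡a+a+a+a = solve-∀
    collect : ∀ a x y z e → a + (x + 1 * e) + (y + 1 * e) + (z + 2 * e) ≡ a + x + y + z + 4 * e
    collect = solve-∀

  diagonal-count : 2 * (R + L) ≤ 3 * A + 4 * e
  diagonal-count = begin
    2 * (R + L)                 ≡⟨ 2*[r+l]≡r+r+l+l R L ⟩
    R + R + L + L               ≤⟨ +-mono-≤ (+-mono-≤ (+-monoʳ-≤ R up-left) up) left ⟩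
    R + (Y₁ + 2 * e) + (Y₂ + 1 * e) + (Y₃ + 1 * e) ≡⟨ collect R Y₁ Y₂ Y₃ e ⟩
    R + Y₁ + Y₂ + Y₃ + 4 * e    ≡⟨ cong (_+ 4 * e) (Σdisc-+₄ R2 diag _ _ _) ⟨
    Σdisc R2 (λ i j → w i j * w (i ℤ.+ + 1) (j ℤ.+ + 1) + w (i ℤ.- + 1) (j ℤ.- + 1) * w i j
                    + w i j * w (i ℤ.- + 1) (j ℤ.+ + 1) + w (i ℤ.+ + 1) (j ℤ.- + 1) * w i j) + 4 * e
      ≤⟨ +-monoˡ-≤ (4 * e) (Σdisc-mono R2 star≤) ⟩
    Σdisc R2 (λ i j → 3 * w i j) + 4 * e ≡⟨ cong (_+ 4 * e) (Σdisc-* R2 3 w) ⟩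
    3 * A + 4 * e ∎
    where
    open ≤-Reasoning
    Y₁ = Σdisc R2 (λ i j → w (i ℤ.- + 1) (j ℤ.- + 1) * w i j)
    Y₂ = Σdisc R2 (λ i j → w i j * w (i ℤ.- + 1) (j ℤ.+ + 1))
    Y₃ = Σdisc R2 (λ i j → w (i ℤ.+ + 1) (j ℤ.- + 1) * w i j)
    k-1+1≡k : ∀ k → k ℤ.- + 1 ℤ.+ + 1 ≡ k
    k-1+1≡k = ℤSolver.solve-∀
    up-left : R ≤ Y₁ + 2 * e
    up-left = Σdisc-translate R2 -[1+ 0 ] -[1+ 0 ] diag≤1
      (λ i j → cong₂ (λ x y → w (i ℤ.- + 1) (j ℤ.- + 1) * w x y) (sym (k-1+1≡k i)) (sym (k-1+1≡k j)))
    up : L ≤ Y₂ + 1 * e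
    up = Σdisc-translate R2 -[1+ 0 ] (+ 0) anti≤1
      (λ i j → cong₂ (λ x y → w x y * w (i ℤ.- + 1) (y ℤ.+ + 1)) (sym (k-1+1≡k i)) (sym (ℤP.+-identityʳ j)))
    left : L ≤ Y₃ + 1 * e
    left = Σdisc-translate R2 (+ 0) -[1+ 0 ] anti≤1
      (λ i j → cong₂ (λ x y → w (x ℤ.+ + 1) (j ℤ.- + 1) * w x y) (sym (ℤP.+-identityʳ i)) (sym (k-1+1≡k j)))
    2*[r+l]≡r+r+l+l : ∀ r l → 2 * (r + l) ≡ r + r + l + l
    2*[r+l]≡r+r+l+l = solve-∀
    collect : ∀ r x y z e → r + (x + 2 * e) + (y + 1 * e) + (z + 1 * e) ≡ r + x + y + z + 4 * e
    collect = solve-∀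

  five-wild≤two-disc : 5 * A ≤ 2 * D + 12 * e
  five-wild≤two-disc = +-cancelʳ-≤ (3 * A) (5 * A) (2 * D + 12 * e) (begin
    5 * A + 3 * A                   ≡⟨ 5a+3a≡2*[4a] A ⟩
    2 * (4 * A)                     ≤⟨ *-monoʳ-≤ 2 block-count ⟩
    2 * (D + R + L + 4 * e)         ≡⟨ expand D R L e ⟩
    2 * D + 2 * (R + L) + 8 * e     ≤⟨ +-monoˡ-≤ (8 * e) (+-monoʳ-≤ (2 * D) diagonal-count) ⟩
    2 * D + (3 * A + 4 * e) + 8 * e ≡⟨ regroup A D e ⟩
    2 * D + 12 * e + 3 * A          ∎)
    where
    open ≤-Reasoning
    5a+3a≡2*[4a] : ∀ a → 5 * a + 3 * a ≡ 2 * (4 * a)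
    5a+3a≡2*[4a] = solve-∀
    expand : ∀ d r l e → 2 * (d + r + l + 4 * e) ≡ 2 * d + 2 * (r + l) + 8 * e
    expand = solve-∀
    regroup : ∀ a d e → 2 * d + (3 * a + 4 * e) + 8 * e ≡ 2 * d + 12 * e + 3 * a
    regroup = solve-∀

wildCount-upper : ∀ {M} → IsSL2Tiling M → ∀ R2 → 5 * wildCount M R2 ≤ 2 * discCount R2 + 12 * rowCount R2
wildCount-upper {M} T R2 =
  subst₂ (λ w d → 5 * w ≤ 2 * d + 12 * rowCount R2) (sym (wildCount≡Σdisc M R2)) (sym (discCount≡Σdisc R2))
    (UpperBound.five-wild≤two-disc {M} T R2)

multiple-of-modulus : ∀ {m r r′} δ → r < m → r′ < m → + r ℤ.- + r′ ≡ δ ℤ.* + m → r ≡ r′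
multiple-of-modulus (+ zero) _ _ eq = ℤP.+-injective (ℤP.i-j≡0⇒i≡j _ _ eq)
multiple-of-modulus {m} {r} {r′} (+ suc t) r<m _ eq = contradiction r<m (≤⇒≯ m≤r)
  where
  a≡b+[a-b] : ∀ a b → a ≡ b ℤ.+ (a ℤ.- b)
  a≡b+[a-b] = ℤSolver.solve-∀
  r≡r′+[1+t]m : + r ≡ + (r′ + suc t * m)
  r≡r′+[1+t]m = trans (a≡b+[a-b] (+ r) (+ r′)) (cong (ℤ._+_ (+ r′)) (trans eq (sym (ℤP.pos-* (suc t) m))))
  m≤r : m ≤ r
  m≤r = ≤-trans (≤-trans (m≤m+n m (t * m)) (m≤n+m _ r′)) (≤-reflexive (sym (ℤP.+-injective r≡r′+[1+t]m)))
multiple-of-modulus {m} {r} {r′} -[1+ t ] r<m r′<m eq =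
  sym (multiple-of-modulus (+ suc t) r′<m r<m (trans (b-a≡-[a-b] (+ r) (+ r′)) (trans (cong ℤ.-_ eq) (-[-c*m]≡c*m (+ suc t) (+ m)))))
  where
  b-a≡-[a-b] : ∀ a b → b ℤ.- a ≡ ℤ.- (a ℤ.- b)
  b-a≡-[a-b] = ℤSolver.solve-∀
  -[-c*m]≡c*m : ∀ c m → ℤ.- (ℤ.- c ℤ.* m) ≡ c ℤ.* m
  -[-c*m]≡c*m = ℤSolver.solve-∀

%ℕ-unique : ∀ m .{{_ : NonZero m}} {x r} q → r < m → x ≡ + r ℤ.+ q ℤ.* + m → x %ℕ m ≡ r
%ℕ-unique m {x} {r} q r<m x≡r+qm = multiple-of-modulus (q ℤ.- x /ℕ m) (n%ℕd<d x m) r<m (begin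
  + (x %ℕ m) ℤ.- + r
    ≡⟨ shift (+ (x %ℕ m)) (+ r) (x /ℕ m) q (+ m) ⟩
  (+ (x %ℕ m) ℤ.+ x /ℕ m ℤ.* + m) ℤ.- (+ r ℤ.+ q ℤ.* + m) ℤ.+ (q ℤ.- x /ℕ m) ℤ.* + m
    ≡⟨ cong₂ (λ u v → u ℤ.- v ℤ.+ (q ℤ.- x /ℕ m) ℤ.* + m) (sym (a≡a%ℕn+[a/ℕn]*n x m)) (sym x≡r+qm) ⟩
  x ℤ.- x ℤ.+ (q ℤ.- x /ℕ m) ℤ.* + m
    ≡⟨ cancel x ((q ℤ.- x /ℕ m) ℤ.* + m) ⟩
  (q ℤ.- x /ℕ m) ℤ.* + m ∎)
  where
  open ≡-Reasoning
  shift : ∀ r′ r q′ q m → r′ ℤ.- r ≡ (r′ ℤ.+ q′ ℤ.* m) ℤ.- (r ℤ.+ q ℤ.* m) ℤ.+ (q ℤ.- q′) ℤ.* m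
  shift = ℤSolver.solve-∀
  cancel : ∀ x y → x ℤ.- x ℤ.+ y ≡ y
  cancel = ℤSolver.solve-∀

%ℕ-distrib-+ : ∀ x y m .{{_ : NonZero m}} → (x ℤ.+ y) %ℕ m ≡ (x %ℕ m + y %ℕ m) % m
%ℕ-distrib-+ x y m = %ℕ-unique m (+ (s ℕ./ m) ℤ.+ x /ℕ m ℤ.+ y /ℕ m) (m%n<n s m) (begin
  x ℤ.+ y
    ≡⟨ cong₂ ℤ._+_ (a≡a%ℕn+[a/ℕn]*n x m) (a≡a%ℕn+[a/ℕn]*n y m) ⟩
  (+ (x %ℕ m) ℤ.+ x /ℕ m ℤ.* + m) ℤ.+ (+ (y %ℕ m) ℤ.+ y /ℕ m ℤ.* + m)
    ≡⟨ regroup (+ (x %ℕ m)) (+ (y %ℕ m)) (x /ℕ m) (y /ℕ m) (+ m) ⟩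
  + s ℤ.+ (x /ℕ m ℤ.+ y /ℕ m) ℤ.* + m
    ≡⟨ cong (ℤ._+ (x /ℕ m ℤ.+ y /ℕ m) ℤ.* + m) (a≡a%ℕn+[a/ℕn]*n (+ s) m) ⟩
  + (s % m) ℤ.+ + (s ℕ./ m) ℤ.* + m ℤ.+ (x /ℕ m ℤ.+ y /ℕ m) ℤ.* + m
    ≡⟨ regroup′ (+ (s % m)) (+ (s ℕ./ m)) (x /ℕ m) (y /ℕ m) (+ m) ⟩
  + (s % m) ℤ.+ (+ (s ℕ./ m) ℤ.+ x /ℕ m ℤ.+ y /ℕ m) ℤ.* + m ∎)
  where
  open ≡-Reasoning
  s = x %ℕ m + y %ℕ m
  regroup : ∀ a b q q′ m → (a ℤ.+ q ℤ.* m) ℤ.+ (b ℤ.+ q′ ℤ.* m) ≡ a ℤ.+ b ℤ.+ (q ℤ.+ q′) ℤ.* m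
  regroup = ℤSolver.solve-∀
  regroup′ : ∀ r p q q′ m → r ℤ.+ p ℤ.* m ℤ.+ (q ℤ.+ q′) ℤ.* m ≡ r ℤ.+ (p ℤ.+ q ℤ.+ q′) ℤ.* m
  regroup′ = ℤSolver.solve-∀

-- The construction

-- L is read off j + 3i mod 10 and, since i − j ≡ −(j + 3i) mod 4, so is sin(π(i − j)/2); hence the
-- construction only depends on the phase j + 3i mod 20, and value A z is its entry at phase z when
-- the prescribed entry there is A.
phase : ℤ → ℤ → ℕ
phase i j = (j ℤ.+ + 3 ℤ.* i) %ℕ 20

phase<20 : ∀ i j → phase i j < 20
phase<20 i j = n%ℕd<d (j ℤ.+ + 3 ℤ.* i) 20

phase-translate : ∀ {i j i′ j′} a b → i′ ≡ i ℤ.+ a → j′ ≡ j ℤ.+ b →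
                  phase i′ j′ ≡ (phase i j + (b ℤ.+ + 3 ℤ.* a) %ℕ 20) % 20
phase-translate {i} {j} a b refl refl =
  trans (cong (_%ℕ 20) (regroup i j a b)) (%ℕ-distrib-+ (j ℤ.+ + 3 ℤ.* i) (b ℤ.+ + 3 ℤ.* a) 20)
  where
  regroup : ∀ i j a b → j ℤ.+ b ℤ.+ + 3 ℤ.* (i ℤ.+ a) ≡ (j ℤ.+ + 3 ℤ.* i) ℤ.+ (b ℤ.+ + 3 ℤ.* a)
  regroup = ℤSolver.solve-∀

InL-phase : ∀ i j → (j ℤ.+ + 3 ℤ.* i) %ℕ 10 ≡ phase i j % 10
InL-phase i j = %ℕ-unique 10 (+ (p ℕ./ 10) ℤ.+ y /ℕ 20 ℤ.* + 2) (m%n<n p 10) (begin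
  y                                                   ≡⟨ a≡a%ℕn+[a/ℕn]*n y 20 ⟩
  + p ℤ.+ y /ℕ 20 ℤ.* + 20                            ≡⟨ cong (ℤ._+ y /ℕ 20 ℤ.* + 20) (a≡a%ℕn+[a/ℕn]*n (+ p) 10) ⟩
  + (p % 10) ℤ.+ + (p ℕ./ 10) ℤ.* + 10 ℤ.+ y /ℕ 20 ℤ.* + 20 ≡⟨ regroup (+ (p % 10)) (+ (p ℕ./ 10)) (y /ℕ 20) ⟩
  + (p % 10) ℤ.+ (+ (p ℕ./ 10) ℤ.+ y /ℕ 20 ℤ.* + 2) ℤ.* + 10 ∎)
  where
  open ≡-Reasoning
  y = j ℤ.+ + 3 ℤ.* i
  p = phase i j
  regroup : ∀ r q Q → r ℤ.+ q ℤ.* + 10 ℤ.+ Q ℤ.* + 20 ≡ r ℤ.+ (q ℤ.+ Q ℤ.* + 2) ℤ.* + 10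
  regroup = ℤSolver.solve-∀

i-j-phase : ∀ i j → (i ℤ.- j) %ℕ 4 ≡ (20 ∸ phase i j) % 4
i-j-phase i j = %ℕ-unique 4 (+ (u ℕ./ 4) ℤ.- + 5 ℤ.+ i ℤ.- y /ℕ 20 ℤ.* + 5) (m%n<n u 4) (begin
  i ℤ.- j                                              ≡⟨ via-y i j ⟩
  + 4 ℤ.* i ℤ.- y                                      ≡⟨ cong (λ v → + 4 ℤ.* i ℤ.- v) (a≡a%ℕn+[a/ℕn]*n y 20) ⟩
  + 4 ℤ.* i ℤ.- (+ p ℤ.+ y /ℕ 20 ℤ.* + 20)             ≡⟨ cong (λ v → + 4 ℤ.* i ℤ.- (v ℤ.+ y /ℕ 20 ℤ.* + 20)) p≡20-u ⟩
  + 4 ℤ.* i ℤ.- (+ 20 ℤ.- + u ℤ.+ y /ℕ 20 ℤ.* + 20)    ≡⟨ cong (λ v → + 4 ℤ.* i ℤ.- (+ 20 ℤ.- v ℤ.+ y /ℕ 20 ℤ.* + 20))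
                                                               (a≡a%ℕn+[a/ℕn]*n (+ u) 4) ⟩
  + 4 ℤ.* i ℤ.- (+ 20 ℤ.- (+ (u % 4) ℤ.+ + (u ℕ./ 4) ℤ.* + 4) ℤ.+ y /ℕ 20 ℤ.* + 20)
                                                       ≡⟨ regroup i (+ (u % 4)) (+ (u ℕ./ 4)) (y /ℕ 20) ⟩
  + (u % 4) ℤ.+ (+ (u ℕ./ 4) ℤ.- + 5 ℤ.+ i ℤ.- y /ℕ 20 ℤ.* + 5) ℤ.* + 4 ∎)
  where
  open ≡-Reasoning
  y = j ℤ.+ + 3 ℤ.* i
  p = phase i j
  u = 20 ∸ p
  via-y : ∀ i j → i ℤ.- j ≡ + 4 ℤ.* i ℤ.- (j ℤ.+ + 3 ℤ.* i)
  via-y = ℤSolver.solve-∀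
  a≡[a+b]-b : ∀ a b → a ≡ a ℤ.+ b ℤ.- b
  a≡[a+b]-b = ℤSolver.solve-∀
  p≡20-u : + p ≡ + 20 ℤ.- + u
  p≡20-u = trans (a≡[a+b]-b (+ p) (+ u)) (cong (λ v → + v ℤ.- + u) (m+[n∸m]≡n (<⇒≤ (phase<20 i j))))
  regroup : ∀ i r q Q → + 4 ℤ.* i ℤ.- (+ 20 ℤ.- (r ℤ.+ q ℤ.* + 4) ℤ.+ Q ℤ.* + 20) ≡
                        r ℤ.+ (q ℤ.- + 5 ℤ.+ i ℤ.- Q ℤ.* + 5) ℤ.* + 4
  regroup = ℤSolver.solve-∀

sinTab : ℕ → ℤ
sinTab 0                   = + 0
sinTab 1                   = + 1
sinTab 2                   = + 0
sinTab (suc (suc (suc _))) = -[1+ 0 ]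

sinHalfPi≡sinTab : ∀ k → sinHalfPi k ≡ sinTab (k %ℕ 4)
sinHalfPi≡sinTab k with k %ℕ 4
... | 0                   = refl
... | 1                   = refl
... | 2                   = refl
... | suc (suc (suc _))   = refl

value : ℤ → ℕ → ℤ
value A z with z % 10
... | zero  = A
... | suc _ = sinTab ((20 ∸ z) % 4)

value-on-L : ∀ A z → z % 10 ≡ 0 → value A z ≡ A
value-on-L A z z∈L with z % 10
... | zero = refl

value-off-L : ∀ A z → z % 10 ≢ 0 → value A z ≡ sinTab ((20 ∸ z) % 4)
value-off-L A z z∉L with z % 10
... | zero  = contradiction refl z∉L
... | suc _ = refl

construction-value : ∀ a i j → construction a i j ≡ value (a i j) (phase i j)
construction-value a i j with InL? i j
... | yes ij∈L = sym (value-on-L (a i j) (phase i j) (trans (sym (InL-phase i j)) ij∈L))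
... | no  ij∉L = trans (sinHalfPi≡sinTab (i ℤ.- j))
                       (trans (cong sinTab (i-j-phase i j))
                              (sym (value-off-L (a i j) (phase i j) (ij∉L ∘ trans (InL-phase i j)))))

pattern 20+_ n = suc (suc (suc (suc (suc (suc (suc (suc (suc (suc (suc (suc (suc (suc (suc (suc (suc (suc (suc (suc n)))))))))))))))))))

tile-at : ∀ z → z < 20 → ∀ A B C D →
          value A z ℤ.* value B ((z + 4) % 20) ℤ.- value C ((z + 1) % 20) ℤ.* value D ((z + 3) % 20) ≡ + 1
tile-at 0 _ A B C D = cong (ℤ._- -[1+ 0 ]) (ℤP.*-zeroʳ A)
tile-at 1 _ A B C D = refl
tile-at 2 _ A B C D = refl
tile-at 3 _ A B C D = refl
tile-at 4 _ A B C D = refl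
tile-at 5 _ A B C D = refl
tile-at 6 _ A B C D = refl
tile-at 7 _ A B C D = refl
tile-at 8 _ A B C D = refl
tile-at 9 _ A B C D = cong (ℤ._-_ (+ 1)) (ℤP.*-zeroʳ C)
tile-at 10 _ A B C D = cong (ℤ._- -[1+ 0 ]) (ℤP.*-zeroʳ A)
tile-at 11 _ A B C D = refl
tile-at 12 _ A B C D = refl
tile-at 13 _ A B C D = refl
tile-at 14 _ A B C D = refl
tile-at 15 _ A B C D = refl
tile-at 16 _ A B C D = refl
tile-at 17 _ A B C D = refl
tile-at 18 _ A B C D = refl
tile-at 19 _ A B C D = cong (ℤ._-_ (+ 1)) (ℤP.*-zeroʳ C)
tile-at (20+ n) 20+n<20 = contradiction 20+n<20 (m+n≮m 20 n)

construction-near : ∀ a {i j i′ j′} d₁ d₂ → i′ ≡ i ℤ.+ d₁ → j′ ≡ j ℤ.+ d₂ →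
                    construction a i′ j′ ≡ value (a i′ j′) ((phase i j + (d₂ ℤ.+ + 3 ℤ.* d₁) %ℕ 20) % 20)
construction-near a {i} {j} {i′} {j′} d₁ d₂ i′≡ j′≡ =
  trans (construction-value a i′ j′) (cong (value (a i′ j′)) (phase-translate {i} {j} d₁ d₂ i′≡ j′≡))

construction-tiling : ∀ a → IsSL2Tiling (construction a)
construction-tiling a i j = trans
  (cong₂ ℤ._-_ (cong₂ ℤ._*_ (construction-value a i j) (construction-near a {i} {j} (+ 1) (+ 1) refl refl))
               (cong₂ ℤ._*_ (construction-near a {i} {j} (+ 0) (+ 1) (sym (ℤP.+-identityʳ i)) refl)
                            (construction-near a {i} {j} (+ 1) (+ 0) refl (sym (ℤP.+-identityʳ j)))))
  (tile-at (phase i j) (phase<20 i j) _ _ _ _)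

NonzeroOnL : ℤ → ℕ → Set
NonzeroOnL A z = z % 10 ≡ 0 → A ≢ + 0

value-zero⇔ : ∀ A z → NonzeroOnL A z → value A z ≡ + 0 ⇔ value (+ 1) z ≡ + 0
value-zero⇔ A z A≢0 with z % 10
... | zero  = mk⇔ (λ A≡0 → contradiction A≡0 (A≢0 refl)) (λ ())
... | suc _ = mk⇔ id id

only-corner₁ : ∀ x → x ℤ.+ + 0 ℤ.+ + 0 ℤ.+ + 0 ≡ x
only-corner₁ = ℤSolver.solve-∀

only-corner₂ : ∀ x → + 0 ℤ.+ x ℤ.+ + 0 ℤ.+ + 0 ≡ x
only-corner₂ = ℤSolver.solve-∀

only-corner₃ : ∀ x → + 0 ℤ.+ + 0 ℤ.+ x ℤ.+ + 0 ≡ x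
only-corner₃ = ℤSolver.solve-∀

only-corner₄ : ∀ x → + 0 ℤ.+ + 0 ℤ.+ + 0 ℤ.+ x ≡ x
only-corner₄ = ℤSolver.solve-∀

-- At a zero phase exactly one of the four diagonal neighbours lies on L; the other three vanish.
corners-at : ∀ z → z < 20 → value (+ 1) z ≡ + 0 → ∀ {a₁ a₃ a₇ a₉} →
  NonzeroOnL a₁ ((z + 16) % 20) → NonzeroOnL a₃ ((z + 18) % 20) →
  NonzeroOnL a₇ ((z + 2) % 20) → NonzeroOnL a₉ ((z + 4) % 20) →
  value a₁ ((z + 16) % 20) ℤ.+ value a₃ ((z + 18) % 20) ℤ.+ value a₇ ((z + 2) % 20) ℤ.+ value a₉ ((z + 4) % 20) ≢ + 0
corners-at 0 _ ()
corners-at 1 _ ()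
corners-at 2 _ _ _ h₃ _ _ = h₃ refl ∘ trans (sym (only-corner₂ _))
corners-at 3 _ ()
corners-at 4 _ _ h₁ _ _ _ = h₁ refl ∘ trans (sym (only-corner₁ _))
corners-at 5 _ ()
corners-at 6 _ _ _ _ _ h₉ = h₉ refl ∘ trans (sym (only-corner₄ _))
corners-at 7 _ ()
corners-at 8 _ _ _ _ h₇ _ = h₇ refl ∘ trans (sym (only-corner₃ _))
corners-at 9 _ ()
corners-at 10 _ ()
corners-at 11 _ ()
corners-at 12 _ _ _ h₃ _ _ = h₃ refl ∘ trans (sym (only-corner₂ _))
corners-at 13 _ ()
corners-at 14 _ _ h₁ _ _ _ = h₁ refl ∘ trans (sym (only-corner₁ _))
corners-at 15 _ ()
corners-at 16 _ _ _ _ _ h₉ = h₉ refl ∘ trans (sym (only-corner₄ _))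
corners-at 17 _ ()
corners-at 18 _ _ _ _ h₇ _ = h₇ refl ∘ trans (sym (only-corner₃ _))
corners-at 19 _ ()
corners-at (20+ n) 20+n<20 = contradiction 20+n<20 (m+n≮m 20 n)

module Construction (a : Array) (a≢0 : ∀ i j → InL i j → ¬ a i j ≡ + 0) where

  C : Array
  C = construction a

  open SL2Tiling {C} (construction-tiling a)

  nonzero-here : ∀ i j → NonzeroOnL (a i j) (phase i j)
  nonzero-here i j z%10≡0 = a≢0 i j (trans (InL-phase i j) z%10≡0)

  nonzero-near : ∀ {i j i′ j′} d₁ d₂ → i′ ≡ i ℤ.+ d₁ → j′ ≡ j ℤ.+ d₂ →
                 NonzeroOnL (a i′ j′) ((phase i j + (d₂ ℤ.+ + 3 ℤ.* d₁) %ℕ 20) % 20)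
  nonzero-near {i} {j} {i′} {j′} d₁ d₂ i′≡ j′≡ z%10≡0 =
    nonzero-here i′ j′ (trans (cong (_% 10) (phase-translate {i} {j} d₁ d₂ i′≡ j′≡)) z%10≡0)

  zero⇔zero-phase : ∀ i j → C i j ≡ + 0 ⇔ value (+ 1) (phase i j) ≡ + 0
  zero⇔zero-phase i j = ⇔-trans (mk⇔ (trans (sym (construction-value a i j))) (trans (construction-value a i j)))
                                (value-zero⇔ (a i j) (phase i j) (nonzero-here i j))

  zero⇒wild : ∀ i j → C i j ≡ + 0 → Wild C i j
  zero⇒wild i j Cij≡0 det≡0 =
    corners-at (phase i j) (phase<20 i j) (Equivalence.to (zero⇔zero-phase i j) Cij≡0)
      (nonzero-near {i} {j} -[1+ 0 ] -[1+ 0 ] refl refl) (nonzero-near {i} {j} -[1+ 0 ] (+ 1) refl refl)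
      (nonzero-near {i} {j} (+ 1) -[1+ 0 ] refl refl) (nonzero-near {i} {j} (+ 1) (+ 1) refl refl)
      (begin
        _ ≡⟨ cong₂ ℤ._+_ (cong₂ ℤ._+_ (cong₂ ℤ._+_ (near -[1+ 0 ] -[1+ 0 ]) (near -[1+ 0 ] (+ 1))) (near (+ 1) -[1+ 0 ]))
                         (near (+ 1) (+ 1)) ⟨
        C (i ℤ.- + 1) (j ℤ.- + 1) ℤ.+ C (i ℤ.- + 1) (j ℤ.+ + 1) ℤ.+ C (i ℤ.+ + 1) (j ℤ.- + 1) ℤ.+ C (i ℤ.+ + 1) (j ℤ.+ + 1)
          ≡⟨ centredDet-at-zero {i} {j} Cij≡0 ⟨
        centredDet C i j ≡⟨ det≡0 ⟩
        + 0 ∎)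
    where
    open ≡-Reasoning
    near : ∀ d₁ d₂ → C (i ℤ.+ d₁) (j ℤ.+ d₂) ≡
                     value (a (i ℤ.+ d₁) (j ℤ.+ d₂)) ((phase i j + (d₂ ℤ.+ + 3 ℤ.* d₁) %ℕ 20) % 20)
    near d₁ d₂ = construction-near a {i} {j} d₁ d₂ refl refl

  wild⇔zero-phase : ∀ i j → Wild C i j ⇔ value (+ 1) (phase i j) ≡ + 0
  wild⇔zero-phase i j = ⇔-trans (mk⇔ (wild⇒zero {i} {j}) (zero⇒wild i j)) (zero⇔zero-phase i j)

-- The lower bound for the construction

zero-indicator : ℕ → ℕ
zero-indicator z = χ (value (+ 1) z ℤ.≟ + 0)

window-table : All (λ z → Σ< 10 (λ k → zero-indicator ((z + k) % 20)) ≡ 4) (upTo 20)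
window-table = from-yes (all? (λ z → Σ< 10 (λ k → zero-indicator ((z + k) % 20)) ℕ.≟ 4) (upTo 20))

module LowerBound (a : Array) (a≢0 : ∀ i j → InL i j → ¬ a i j ≡ + 0) (R2 : ℕ) where

  open Construction a a≢0

  w : ℤ → ℤ → ℕ
  w i j = χ (wild? C i j)

  w≤1 : Bounded w
  w≤1 i j = χ≤1 (wild? C i j)

  w≡zero-indicator : ∀ i j → w i j ≡ zero-indicator (phase i j)
  w≡zero-indicator i j = χ-cong (wild? C i j) (value (+ 1) (phase i j) ℤ.≟ + 0)
                                (Equivalence.to (wild⇔zero-phase i j)) (Equivalence.from (wild⇔zero-phase i j))

  window : ∀ i j → Σ< 10 (λ k → w i (j ℤ.+ + k)) ≡ 4
  window i j = trans (Σ<-cong 10 λ k k<10 → trans (w≡zero-indicator i (j ℤ.+ + k))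
                                                  (cong zero-indicator (phase-shift k (≤-trans k<10 (m≤m+n 10 10)))))
                     (All.lookup window-table (∈-upTo⁺ (phase<20 i j)))
    where
    phase-shift : ∀ k → k < 20 → phase i (j ℤ.+ + k) ≡ (phase i j + k) % 20
    phase-shift k k<20 = trans (phase-translate {i} {j} (+ 0) (+ k) (sym (ℤP.+-identityʳ i)) refl)
                               (cong (λ c → (phase i j + c) % 20) (trans (cong (_% 20) (+-identityʳ k)) (m<n⇒m%n≡m k<20)))

  A D e : ℕ
  A = Σdisc R2 w
  D = Σdisc R2 (λ _ _ → 1)
  e = rowCount R2

  translated : ∀ k → Σdisc R2 (λ i j → w i (j ℤ.+ + k)) ≤ A + k * e
  translated k = subst (λ n → Σdisc R2 (λ i j → w i (j ℤ.+ + k)) ≤ A + n * e) (ℤP.∣-i∣≡∣i∣ (+ k))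
    (Σdisc-translate R2 (+ 0) (ℤ.- + k) (λ i j → w≤1 i (j ℤ.+ + k))
      (λ i j → cong₂ w (sym (ℤP.+-identityʳ i)) (sym (j-k+k≡j j (+ k)))))
    where
    j-k+k≡j : ∀ j k → j ℤ.+ ℤ.- k ℤ.+ k ≡ j
    j-k+k≡j = ℤSolver.solve-∀

  four-disc≤ten-wild : 4 * D ≤ 10 * (A + 10 * e)
  four-disc≤ten-wild = begin
    4 * D                                              ≡⟨ Σdisc-* R2 4 (λ _ _ → 1) ⟨
    Σdisc R2 (λ _ _ → 4)                               ≡⟨ Σdisc-cong R2 (λ i j → sym (window i j)) ⟩
    Σdisc R2 (λ i j → Σ< 10 (λ k → w i (j ℤ.+ + k)))   ≡⟨ Σdisc-Σ< R2 10 (λ i j k → w i (j ℤ.+ + k)) ⟩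
    Σ< 10 (λ k → Σdisc R2 (λ i j → w i (j ℤ.+ + k)))   ≤⟨ Σ<-mono 10 (λ k k<10 → ≤-trans (translated k)
                                                             (+-monoʳ-≤ A (*-monoˡ-≤ e (<⇒≤ k<10)))) ⟩
    Σ< 10 (λ _ → A + 10 * e)                           ≡⟨ Σ<-const 10 (A + 10 * e) ⟩
    10 * (A + 10 * e)                                  ∎
    where open ≤-Reasoning

wildCount-lower : ∀ a → (∀ i j → InL i j → ¬ a i j ≡ + 0) →
                  ∀ R2 → 2 * discCount R2 ≤ 5 * wildCount (construction a) R2 + 50 * rowCount R2
wildCount-lower a a≢0 R2 =
  subst₂ (λ d w → 2 * d ≤ 5 * w + 50 * rowCount R2) (sym (discCount≡Σdisc R2)) (sym (wildCount≡Σdisc (construction a) R2))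
    (*-cancelˡ-≤ 2 (≤-trans (≤-reflexive (sym (*-assoc 2 2 D))) (≤-trans four-disc≤ten-wild (≤-reflexive (halve A e)))))
  where
  open LowerBound a a≢0 R2
  halve : ∀ a e → 10 * (a + 10 * e) ≡ 2 * (5 * a + 50 * e)
  halve = solve-∀

n/1≡mkℚ : ∀ n → + n / 1 ≡ mkℚ (+ n) 0 (Coprime.sym (Coprime.1-coprimeTo n))
n/1≡mkℚ n = ℚP.normalize-coprime (Coprime.sym (Coprime.1-coprimeTo n))

toℚᵘ-[2/5+ε]*d : ∀ ε d → toℚᵘ ((+ 2 / 5 ℚ.+ ε) ℚ.* mkℚ (+ d) 0 (Coprime.sym (Coprime.1-coprimeTo d))) ℚᵘ.≃
                          (toℚᵘ (+ 2 / 5) ℚᵘ.+ toℚᵘ ε) ℚᵘ.* ℚᵘ.mkℚᵘ (+ d) 0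
toℚᵘ-[2/5+ε]*d ε d =
  ℚᵘP.≃-trans (ℚP.toℚᵘ-homo-* (+ 2 / 5 ℚ.+ ε) _) (ℚᵘP.*-congʳ (ℚP.toℚᵘ-homo-+ (+ 2 / 5) ε))

-- The hypothesis says w ≤ (2/5 + 1/↧ε)·d, and 1/↧ε ≤ ε.
≤-2/5+ε : ∀ w d ε → Positive ε → 5 * ↧ₙ ε * w ≤ 2 * ↧ₙ ε * d + 5 * d →
          + w / 1 ℚ.≤ (+ 2 / 5 ℚ.+ ε) ℚ.* (+ d / 1)
≤-2/5+ε w d ε@(mkℚ (+ suc n) k _) _ 5Kw≤2Kd+5d rewrite n/1≡mkℚ w | n/1≡mkℚ d =
  ℚP.toℚᵘ-cancel-≤ (ℚᵘP.≤-respʳ-≃ (ℚᵘP.≃-sym (toℚᵘ-[2/5+ε]*d ε d)) (ℚᵘ.*≤* cross))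
  where
  K = suc k
  bound : w * (5 * K * 1) ≤ (2 * K + suc n * 5) * d * 1
  bound = begin
    w * (5 * K * 1)                               ≡⟨ e₁ w K ⟩
    5 * K * w                                     ≤⟨ 5Kw≤2Kd+5d ⟩
    2 * K * d + 5 * d                             ≤⟨ m≤m+n _ (5 * n * d) ⟩
    2 * K * d + 5 * d + 5 * n * d                 ≡⟨ e₂ K n d ⟩
    (2 * K + suc n * 5) * d * 1                   ∎
    where
    open ≤-Reasoning
    e₁ : ∀ w K → w * (5 * K * 1) ≡ 5 * K * w
    e₁ = solve-∀
    e₂ : ∀ K n d → 2 * K * d + 5 * d + 5 * n * d ≡ (2 * K + suc n * 5) * d * 1
    e₂ = solve-∀
  cross : + w ℤ.* + (5 * K * 1) ℤ.≤ ((+ 2 ℤ.* + K ℤ.+ + suc n ℤ.* + 5) ℤ.* + d) ℤ.* + 1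
  cross = begin
    + w ℤ.* + (5 * K * 1)                         ≡⟨ ℤP.pos-* w (5 * K * 1) ⟨
    + (w * (5 * K * 1))                           ≤⟨ ℤ.+≤+ bound ⟩
    + ((2 * K + suc n * 5) * d * 1)               ≡⟨ ℤP.pos-* ((2 * K + suc n * 5) * d) 1 ⟩
    + ((2 * K + suc n * 5) * d) ℤ.* + 1           ≡⟨ cong (ℤ._* + 1) (trans (ℤP.pos-* (2 * K + suc n * 5) d)
                                                        (cong (ℤ._* + d) (trans (ℤP.pos-+ (2 * K) (suc n * 5))
                                                          (cong₂ ℤ._+_ (ℤP.pos-* 2 K) (ℤP.pos-* (suc n) 5))))) ⟩
    ((+ 2 ℤ.* + K ℤ.+ + suc n ℤ.* + 5) ℤ.* + d) ℤ.* + 1 ∎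
    where open ℤP.≤-Reasoning

toℚᵘ-[2/5-ε]*d : ∀ ε d → toℚᵘ ((+ 2 / 5 ℚ.- ε) ℚ.* mkℚ (+ d) 0 (Coprime.sym (Coprime.1-coprimeTo d))) ℚᵘ.≃
                          (toℚᵘ (+ 2 / 5) ℚᵘ.+ toℚᵘ (ℚ.- ε)) ℚᵘ.* ℚᵘ.mkℚᵘ (+ d) 0
toℚᵘ-[2/5-ε]*d ε d =
  ℚᵘP.≃-trans (ℚP.toℚᵘ-homo-* (+ 2 / 5 ℚ.- ε) _) (ℚᵘP.*-congʳ (ℚP.toℚᵘ-homo-+ (+ 2 / 5) (ℚ.- ε)))

2/5-ε-≤ : ∀ w d ε → Positive ε → 2 * ↧ₙ ε * d ≤ 5 * ↧ₙ ε * w + 5 * d →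
          (+ 2 / 5 ℚ.- ε) ℚ.* (+ d / 1) ℚ.≤ + w / 1
2/5-ε-≤ w d ε@(mkℚ (+ suc n) k _) _ 2Kd≤5Kw+5d rewrite n/1≡mkℚ w | n/1≡mkℚ d =
  ℚP.toℚᵘ-cancel-≤ (ℚᵘP.≤-respˡ-≃ (ℚᵘP.≃-sym (toℚᵘ-[2/5-ε]*d ε d)) (ℚᵘ.*≤* cross))
  where
  K = suc k
  X = 2 * K * d
  Y = 5 * suc n * d
  Z = w * (5 * K * 1)
  bound : X ≤ Z + Y
  bound = begin
    2 * K * d                    ≤⟨ 2Kd≤5Kw+5d ⟩
    5 * K * w + 5 * d            ≤⟨ m≤m+n _ (5 * n * d) ⟩
    5 * K * w + 5 * d + 5 * n * d ≡⟨ e K w d n ⟩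
    w * (5 * K * 1) + 5 * suc n * d ∎
    where
    open ≤-Reasoning
    e : ∀ K w d n → 5 * K * w + 5 * d + 5 * n * d ≡ w * (5 * K * 1) + 5 * suc n * d
    e = solve-∀
  cross : ((+ 2 ℤ.* + K ℤ.+ -[1+ n ] ℤ.* + 5) ℤ.* + d) ℤ.* + 1 ℤ.≤ + w ℤ.* + (5 * K * 1)
  cross = begin
    ((+ 2 ℤ.* + K ℤ.+ -[1+ n ] ℤ.* + 5) ℤ.* + d) ℤ.* + 1 ≡⟨ expand (+ K) (+ suc n) (+ d) ⟩
    + 2 ℤ.* + K ℤ.* + d ℤ.- + 5 ℤ.* + suc n ℤ.* + d     ≡⟨ cong₂ ℤ._-_ (pos-*³ 2 K d) (pos-*³ 5 (suc n) d) ⟨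
    + X ℤ.- + Y                                        ≤⟨ ℤP.+-monoˡ-≤ (ℤ.- + Y) (ℤ.+≤+ bound) ⟩
    + (Z + Y) ℤ.- + Y                                  ≡⟨ cong (ℤ._- + Y) (ℤP.pos-+ Z Y) ⟩
    + Z ℤ.+ + Y ℤ.- + Y                                ≡⟨ cancel (+ Z) (+ Y) ⟩
    + Z                                                ≡⟨ ℤP.pos-* w (5 * K * 1) ⟩
    + w ℤ.* + (5 * K * 1)                              ∎
    where
    open ℤP.≤-Reasoning
    expand : ∀ a b c → ((+ 2 ℤ.* a ℤ.+ ℤ.- b ℤ.* + 5) ℤ.* c) ℤ.* + 1 ≡ + 2 ℤ.* a ℤ.* c ℤ.- + 5 ℤ.* b ℤ.* c
    expand = ℤSolver.solve-∀
    pos-*³ : ∀ a b c → + (a * b * c) ≡ + a ℤ.* + b ℤ.* + c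
    pos-*³ a b c = trans (ℤP.pos-* (a * b) c) (cong (ℤ._* + c) (ℤP.pos-* a b))
    cancel : ∀ z y → z ℤ.+ y ℤ.- y ≡ z
    cancel = ℤSolver.solve-∀

wildDensity≤ : ∀ M c → (∀ R2 → 5 * wildCount M R2 ≤ 2 * discCount R2 + c * rowCount R2) →
               WildDensity≤ M (+ 2 / 5)
wildDensity≤ M c bound ε ε>0 = N , λ R2 N≤R2 → ≤-2/5+ε (wildCount M R2) (discCount R2) ε ε>0 (begin
  5 * K * wildCount M R2                     ≡⟨ e₁ K (wildCount M R2) ⟩
  K * (5 * wildCount M R2)                   ≤⟨ *-monoʳ-≤ K (bound R2) ⟩
  K * (2 * discCount R2 + c * rowCount R2)   ≡⟨ e₂ K (discCount R2) c (rowCount R2) ⟩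
  2 * K * discCount R2 + c * K * rowCount R2 ≤⟨ +-monoʳ-≤ _ (≤-trans (negligible R2 N≤R2) (m≤n*m _ 5)) ⟩
  2 * K * discCount R2 + 5 * discCount R2    ∎)
  where
  open ≤-Reasoning
  K = ↧ₙ ε
  N = proj₁ (rowCount-negligible (c * K))
  negligible = proj₂ (rowCount-negligible (c * K))
  e₁ : ∀ K w → 5 * K * w ≡ K * (5 * w)
  e₁ = solve-∀
  e₂ : ∀ K d c r → K * (2 * d + c * r) ≡ 2 * K * d + c * K * r
  e₂ = solve-∀

wildDensity≥ : ∀ M c → (∀ R2 → 2 * discCount R2 ≤ 5 * wildCount M R2 + c * rowCount R2) →
               WildDensity≥ M (+ 2 / 5)
wildDensity≥ M c bound ε ε>0 N₀ = R2 , m≤m+n N₀ N , 2/5-ε-≤ (wildCount M R2) (discCount R2) ε ε>0 (begin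
  2 * K * discCount R2                         ≡⟨ e₁ K (discCount R2) ⟩
  K * (2 * discCount R2)                       ≤⟨ *-monoʳ-≤ K (bound R2) ⟩
  K * (5 * wildCount M R2 + c * rowCount R2)   ≡⟨ e₂ K (wildCount M R2) c (rowCount R2) ⟩
  5 * K * wildCount M R2 + c * K * rowCount R2 ≤⟨ +-monoʳ-≤ _ (≤-trans (negligible R2 (m≤n+m N N₀)) (m≤n*m _ 5)) ⟩
  5 * K * wildCount M R2 + 5 * discCount R2    ∎)
  where
  open ≤-Reasoning
  K = ↧ₙ ε
  N = proj₁ (rowCount-negligible (c * K))
  negligible = proj₂ (rowCount-negligible (c * K))
  R2 = N₀ + N
  e₁ : ∀ K d → 2 * K * d ≡ K * (2 * d)
  e₁ = solve-∀
  e₂ : ∀ K w c r → K * (5 * w + c * r) ≡ 5 * K * w + c * K * r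
  e₂ = solve-∀

theorem1 : ((M : Array) → IsSL2Tiling M → WildDensity≤ M (+ 2 / 5))
    × ((a : Array) → (∀ i j → InL i j → ¬ (a i j ≡ + 0)) →
    IsSL2Tiling (construction a)
    × WildDensity≡ (construction a) (+ 2 / 5)
    × (∀ i j → construction a i j ≡ + 0 → Wild (construction a) i j))
theorem1 = (λ M T → wildDensity≤ M 12 (wildCount-upper {M} T))
         , λ a a≢0 → construction-tiling a
                   , (wildDensity≤ (construction a) 12 (wildCount-upper {construction a} (construction-tiling a))
                     , wildDensity≥ (construction a) 50 (wildCount-lower a a≢0))
                   , Construction.zero⇒wild a a≢0
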